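{- (i) For every integer $j\ge 1$, \[ j\sum_{m=0}^{\left\lfloor j/2\right\rfloor}(-1)^m\binom{j-m}{j-2m}\frac{2^{j-2m-1}}{j-m}\;{}_{2}F_{1}\!\left(\begin{matrix}-m,\ j-m\\ j-2m+2\end{matrix}\,\Big|\,-4\right)F_{j-2m+1}=1. \] (ii) For every integer $j\ge 0$, \[ 2^j\sum_{m=0}^{\left\lfloor j/2\right\rfloor}(-1)^{m+1}\binom{j}{m}\frac{ -j+2m-1}{j-m+1}\;{}_{2}F_{1}\!\left(\begin{matrix}-m,\ -j+m-1\\ -j\end{matrix}\,\Big|\,-\tfrac14\right)F_{j-2m+1}=j+1. \]
   Context: $F_n$ denotes the $n$-th Fibonacci number ($F_0=0$, $F_1=1$, $F_{n+2}=F_{n+1}+F_n$). For a nonnegative integer $m$, ${}_2F_1\!\left(\begin{smallmatrix}-m,\ b\\ c\end{smallmatrix}\big|z\right)=\sum_{k=0}^{m}\frac{(-m)_k(b)_k}{(c)_k\,k!}z^k$, where $(a)_k=a(a+1)\cdots(a+k-1)$. -}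

module Defs where

open import Data.Nat as ℕ using (ℕ; zero; suc; _∸_; _!)
open import Data.Nat.Combinatorics using (_C_)
open import Data.Integer using (+_)
open import Data.Rational as ℚ using (ℚ; 0ℚ; 1ℚ; _+_; _*_; _-_; -_; ≢-nonZero)
open import Data.Rational.Properties using (_≟_)
open import Data.List using (List; map; upTo)
import Data.List as L
open import Relation.Nullary using (yes; no)

⟦_⟧ : ℕ → ℚ
⟦ n ⟧ = (+ n) ℚ./ 1

-- total division on ℚ (x ÷' 0 = 0 by convention; never used with a
-- zero denominator in corollary1)
_÷'_ : ℚ → ℚ → ℚ
p ÷' q with q ≟ 0ℚ
... | yes _  = 0ℚ
... | no q≢0 = ℚ._÷_ p q {{≢-nonZero q≢0}}
infixl 7 _÷'_

_^ℚ_ : ℚ → ℕ → ℚ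
x ^ℚ zero  = 1ℚ
x ^ℚ suc n = x * (x ^ℚ n)
infixr 8 _^ℚ_

poch : ℚ → ℕ → ℚ
poch a zero    = 1ℚ
poch a (suc k) = poch a k * (a + ⟦ k ⟧)

sumTo : ℕ → (ℕ → ℚ) → ℚ
sumTo n f = L.foldr _+_ 0ℚ (map f (upTo (suc n)))

hyp2F1 : ℕ → ℚ → ℚ → ℚ → ℚ
hyp2F1 m b c z =
  sumTo m (λ k → (poch (- ⟦ m ⟧) k * poch b k) ÷' (poch c k * ⟦ k ! ⟧) * z ^ℚ k)

fib : ℕ → ℕ
fib zero          = 0
fib (suc zero)    = 1
fib (suc (suc n)) = fib (suc n) ℕ.+ fib n

sgn : ℕ → ℚ
sgn m = (- 1ℚ) ^ℚ m

-- left-hand side of (i):  j Σ_{m=0}^{⌊j/2⌋} (-1)^m C(j-m, j-2m) 2^{j-2m-1}/(j-m)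
--   2F1(-m, j-m; j-2m+2 | -4) F_{j-2m+1}
-- (2^{j-2m-1} written as 2^{j-2m}/2, which is 1/2 when j = 2m)
lhs1 : ℕ → ℚ
lhs1 j = ⟦ j ⟧ * sumTo (j ℕ./ 2) (λ m →
    sgn m * ⟦ (j ∸ m) C (j ∸ 2 ℕ.* m) ⟧
    * (⟦ 2 ℕ.^ (j ∸ 2 ℕ.* m) ⟧ ÷' ⟦ 2 ⟧ ÷' ⟦ j ∸ m ⟧)
    * hyp2F1 m ⟦ j ∸ m ⟧ (⟦ j ∸ 2 ℕ.* m ⟧ + ⟦ 2 ⟧) (- ⟦ 4 ⟧)
    * ⟦ fib (j ∸ 2 ℕ.* m ℕ.+ 1) ⟧)

lhs2 : ℕ → ℚ
lhs2 j = ⟦ 2 ℕ.^ j ⟧ * sumTo (j ℕ./ 2) (λ m →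
    sgn (suc m) * ⟦ j C m ⟧
    * ((- ⟦ j ⟧ + ⟦ 2 ℕ.* m ⟧ - 1ℚ) ÷' (⟦ j ⟧ - ⟦ m ⟧ + 1ℚ))
    * hyp2F1 m (- ⟦ j ⟧ + ⟦ m ⟧ - 1ℚ) (- ⟦ j ⟧) (- (1ℚ ÷' ⟦ 4 ⟧))
    * ⟦ fib (j ∸ 2 ℕ.* m ℕ.+ 1) ⟧)

{-# OPTIONS --safe #-}

-- Expand each ₂F₁ and interchange the sums over m and k.  After clearing
-- factorials, the (m, k) summand factors as c j k times the signed ballot
-- number (-1)ˡ (C(n, l) - C(n, l - 1)) with n = j - 2k and l = m - k, and
-- ∑_{l ≤ n/2} (-1)ˡ (C(n, l) - C(n, l - 1)) F (n - 2l + 1) = 1 because the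
-- Pascal recurrence telescopes against the Fibonacci recurrence.  So each
-- side collapses to ∑ₖ c j k.  In (ii) c j k = (-1)ᵏ C(j - k, k) 2^(j - 2k) is
-- the k-th coefficient of the Chebyshev polynomial U j, and in (i) it is the
-- k-th coefficient of T j = (U j - U (j - 2)) / 2; the identities are then
-- U j 1 = j + 1 and T j 1 = 1.

module Submission where

open import Defs
open import Data.Nat as ℕ using (ℕ; zero; suc; _∸_; _!; _≤_; _<_; _≥_; z≤n; s≤s)
import Data.Nat.Properties as NP
import Data.Nat.Combinatorics as Comb
import Data.Nat.DivMod as DM
import Data.Nat.Tactic.RingSolver as ℕ-Solver
import Data.Integer as ℤ
import Data.Integer.Properties as ZP
open import Data.Rational as ℚ using (ℚ; 0ℚ; 1ℚ; ½; _+_; _*_; _-_; -_; ≢-nonZero; 1/_)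
open import Data.Rational.Properties as QP using (_≟_)
import Data.Rational.Unnormalised as U
import Data.Rational.Unnormalised.Properties as UP
open import Data.Nat.Combinatorics using (_C_)
open import Data.List using (map; applyUpTo)
import Data.List as L
open import Data.Maybe using (Maybe; just; nothing)
open import Data.Product using (_×_; _,_)
open import Data.Sum using (inj₁; inj₂)
open import Relation.Binary using (tri<; tri≈; tri>)
open import Data.Empty using (⊥-elim)
open import Data.Nat.Divisibility using (divides)
open import Function using (_∘_)
open import Relation.Nullary using (yes; no)
open import Relation.Binary.PropositionalEquality
open import Tactic.RingSolver using (solve-∀)
open import Algebra.Solver.CommutativeMonoid QP.*-1-commutativeMonoid using ()
  renaming (solve to msolve; _⊕_ to _⊕m_; _⊜_ to _⊜m_)
open import Tactic.RingSolver.Core.AlmostCommutativeRing using (AlmostCommutativeRing; fromCommutativeRing)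

ℚ-ring : AlmostCommutativeRing _ _
ℚ-ring = fromCommutativeRing QP.+-*-commutativeRing 0≟
  where
  0≟ : ∀ x → Maybe (0ℚ ≡ x)
  0≟ x with 0ℚ ≟ x
  ... | yes p = just p
  ... | no _  = nothing

*-cancelʳ : ∀ {x y} z → z ≢ 0ℚ → x * z ≡ y * z → x ≡ y
*-cancelʳ {x} {y} z z≢0 eq = trans (sym (undo x)) (trans (cong (_* 1/ z) eq) (undo y))
  where
  instance _ = ≢-nonZero z≢0
  undo : ∀ w → w * z * 1/ z ≡ w
  undo w = trans (QP.*-assoc w z (1/ z)) (trans (cong (w *_) (QP.*-inverseʳ z)) (QP.*-identityʳ w))

*-≢0 : ∀ {x y} → x ≢ 0ℚ → y ≢ 0ℚ → x * y ≢ 0ℚ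
*-≢0 {x} {y} x≢0 y≢0 eq = x≢0 (*-cancelʳ y y≢0 (trans eq (sym (QP.*-zeroˡ y))))

≢0-if-*≡≢0 : ∀ {x y z} → x * y ≡ z → z ≢ 0ℚ → x ≢ 0ℚ
≢0-if-*≡≢0 {x} {y} e z≢0 x≡0 = z≢0 (trans (sym e) (trans (cong (_* y) x≡0) (QP.*-zeroˡ y)))

÷'-*-cancel : ∀ p q → q ≢ 0ℚ → (p ÷' q) * q ≡ p
÷'-*-cancel p q q≢0 with q ≟ 0ℚ
... | yes q≡0 = ⊥-elim (q≢0 q≡0)
... | no q≢0′ = trans (QP.*-assoc p (1/ q) q) (trans (cong (p *_) (QP.*-inverseˡ q)) (QP.*-identityʳ p))
  where instance _ = ≢-nonZero q≢0′

÷'-unique : ∀ {p q x} → q ≢ 0ℚ → x * q ≡ p → p ÷' q ≡ x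
÷'-unique {p} {q} q≢0 eq = *-cancelʳ q q≢0 (trans (÷'-*-cancel p q q≢0) (sym eq))

÷'-self : ∀ {x} → x ≢ 0ℚ → x ÷' x ≡ 1ℚ
÷'-self {x} x≢0 = ÷'-unique x≢0 (QP.*-identityˡ x)

-- An opaque copy of ⟦_⟧, so that neither the ring solver nor the
-- unifier ever unfolds a numeral into its normalised rational.
opaque
  ι : ℕ → ℚ
  ι n = ⟦ n ⟧

opaque
  unfolding ι

  ι≡⟦⟧ : ∀ n → ι n ≡ ⟦ n ⟧
  ι≡⟦⟧ n = refl

private
  ιᵘ : ℕ → U.ℚᵘ
  ιᵘ n = U.mkℚᵘ (ℤ.+ n) 0

  toℚᵘ-⟦⟧ : ∀ n → ℚ.toℚᵘ ⟦ n ⟧ U.≃ ιᵘ n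
  toℚᵘ-⟦⟧ n = QP.toℚᵘ-fromℚᵘ (ιᵘ n)

  ⟦⟧-+ : ∀ a b → ⟦ a ℕ.+ b ⟧ ≡ ⟦ a ⟧ + ⟦ b ⟧
  ⟦⟧-+ a b = QP.toℚᵘ-injective (UP.≃-trans (toℚᵘ-⟦⟧ (a ℕ.+ b)) (UP.≃-trans ιᵘ-+
    (UP.≃-sym (UP.≃-trans (QP.toℚᵘ-homo-+ ⟦ a ⟧ ⟦ b ⟧) (UP.+-cong (toℚᵘ-⟦⟧ a) (toℚᵘ-⟦⟧ b))))))
    where
    ιᵘ-+ : ιᵘ (a ℕ.+ b) U.≃ (ιᵘ a U.+ ιᵘ b)
    ιᵘ-+ = U.*≡* (cong (ℤ._* ℤ.+ 1) (trans (sym (ZP.pos-+ a b))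
             (sym (cong₂ ℤ._+_ (ZP.*-identityʳ (ℤ.+ a)) (ZP.*-identityʳ (ℤ.+ b))))))

  ⟦⟧-* : ∀ a b → ⟦ a ℕ.* b ⟧ ≡ ⟦ a ⟧ * ⟦ b ⟧
  ⟦⟧-* a b = QP.toℚᵘ-injective (UP.≃-trans (toℚᵘ-⟦⟧ (a ℕ.* b)) (UP.≃-trans ιᵘ-*
    (UP.≃-sym (UP.≃-trans (QP.toℚᵘ-homo-* ⟦ a ⟧ ⟦ b ⟧) (UP.*-cong (toℚᵘ-⟦⟧ a) (toℚᵘ-⟦⟧ b))))))
    where
    ιᵘ-* : ιᵘ (a ℕ.* b) U.≃ (ιᵘ a U.* ιᵘ b)
    ιᵘ-* = U.*≡* (cong (ℤ._* ℤ.+ 1) (ZP.pos-* a b))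

  ⟦⟧-injective : ∀ {a b} → ⟦ a ⟧ ≡ ⟦ b ⟧ → a ≡ b
  ⟦⟧-injective {a} {b} eq
    with UP.≃-trans (UP.≃-sym (toℚᵘ-⟦⟧ a)) (UP.≃-trans (UP.≃-reflexive (cong ℚ.toℚᵘ eq)) (toℚᵘ-⟦⟧ b))
  ... | U.*≡* e = ZP.+-injective (trans (sym (ZP.*-identityʳ (ℤ.+ a))) (trans e (ZP.*-identityʳ (ℤ.+ b))))

ι-+ : ∀ a b → ι (a ℕ.+ b) ≡ ι a + ι b
ι-+ a b = trans (ι≡⟦⟧ (a ℕ.+ b)) (trans (⟦⟧-+ a b) (sym (cong₂ _+_ (ι≡⟦⟧ a) (ι≡⟦⟧ b))))

ι-* : ∀ a b → ι (a ℕ.* b) ≡ ι a * ι b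
ι-* a b = trans (ι≡⟦⟧ (a ℕ.* b)) (trans (⟦⟧-* a b) (sym (cong₂ _*_ (ι≡⟦⟧ a) (ι≡⟦⟧ b))))

ι-injective : ∀ {a b} → ι a ≡ ι b → a ≡ b
ι-injective {a} {b} eq = ⟦⟧-injective (trans (sym (ι≡⟦⟧ a)) (trans eq (ι≡⟦⟧ b)))

ι-0 : ι 0 ≡ 0ℚ
ι-0 = ι≡⟦⟧ 0

ι-1 : ι 1 ≡ 1ℚ
ι-1 = ι≡⟦⟧ 1

ι-suc : ∀ n → ι (suc n) ≡ 1ℚ + ι n
ι-suc n = trans (ι-+ 1 n) (cong (_+ ι n) ι-1)

ι-2 : ι 2 ≡ 1ℚ + 1ℚ
ι-2 = trans (ι-suc 1) (cong (1ℚ +_) ι-1)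

ι-suc≢0 : ∀ n → ι (suc n) ≢ 0ℚ
ι-suc≢0 n eq with ι-injective {suc n} {0} (trans eq (sym ι-0))
... | ()

ι≢0 : ∀ {n} → n ≢ 0 → ι n ≢ 0ℚ
ι≢0 {zero}  n≢0 = ⊥-elim (n≢0 refl)
ι≢0 {suc n} _   = ι-suc≢0 n

ι-!≢0 : ∀ n → ι (n !) ≢ 0ℚ
ι-!≢0 n = ι≢0 (ℕ.≢-nonZero⁻¹ (n !) {{NP._!≢0 n}})

ι-suc-! : ∀ n → ι (suc n !) ≡ ι (suc n) * ι (n !)
ι-suc-! n = ι-* (suc n) (n !)

÷2≡*½ : ∀ x → x ÷' ι 2 ≡ x * ½
÷2≡*½ x = ÷'-unique (ι-suc≢0 1) (trans (QP.*-assoc x ½ (ι 2)) (trans (cong (x *_) ½*2≡1) (QP.*-identityʳ x)))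
  where
  ½*2≡1 : ½ * ι 2 ≡ 1ℚ
  ½*2≡1 = cong (½ *_) ι-2

∑ : ℕ → (ℕ → ℚ) → ℚ
∑ zero    f = 0ℚ
∑ (suc n) f = f 0 + ∑ n (f ∘ suc)

sumTo≡∑ : ∀ n f → sumTo n f ≡ ∑ (suc n) f
sumTo≡∑ n f = foldr-applyUpTo (suc n) f (λ i → i)
  where
  foldr-applyUpTo : ∀ n (f : ℕ → ℚ) g → L.foldr _+_ 0ℚ (map f (applyUpTo g n)) ≡ ∑ n (f ∘ g)
  foldr-applyUpTo zero    f g = refl
  foldr-applyUpTo (suc n) f g = cong (f (g 0) +_) (foldr-applyUpTo n f (g ∘ suc))

∑-cong : ∀ n {f g} → (∀ i → i < n → f i ≡ g i) → ∑ n f ≡ ∑ n g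
∑-cong zero    f≡g = refl
∑-cong (suc n) f≡g = cong₂ _+_ (f≡g 0 (s≤s z≤n)) (∑-cong n (λ i i<n → f≡g (suc i) (s≤s i<n)))

∑-zero : ∀ n f → (∀ i → f i ≡ 0ℚ) → ∑ n f ≡ 0ℚ
∑-zero zero    f f≡0 = refl
∑-zero (suc n) f f≡0 = trans (cong₂ _+_ (f≡0 0) (∑-zero n (f ∘ suc) (f≡0 ∘ suc))) (QP.+-identityˡ 0ℚ)

∑-snoc : ∀ n f → ∑ (suc n) f ≡ ∑ n f + f n
∑-snoc zero    f = trans (QP.+-identityʳ (f 0)) (sym (QP.+-identityˡ (f 0)))
∑-snoc (suc n) f =
  trans (cong (f 0 +_) (∑-snoc n (f ∘ suc))) (sym (QP.+-assoc (f 0) (∑ n (f ∘ suc)) (f (suc n))))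

∑-+ : ∀ n f g → ∑ n (λ i → f i + g i) ≡ ∑ n f + ∑ n g
∑-+ zero    f g = refl
∑-+ (suc n) f g = trans (cong ((f 0 + g 0) +_) (∑-+ n (f ∘ suc) (g ∘ suc)))
                        (interchange (f 0) (g 0) (∑ n (f ∘ suc)) (∑ n (g ∘ suc)))
  where
  interchange : ∀ a b c d → (a + b) + (c + d) ≡ (a + c) + (b + d)
  interchange = solve-∀ ℚ-ring

∑-*ˡ : ∀ n c f → c * ∑ n f ≡ ∑ n (λ i → c * f i)
∑-*ˡ zero    c f = QP.*-zeroʳ c
∑-*ˡ (suc n) c f = trans (QP.*-distribˡ-+ c (f 0) (∑ n (f ∘ suc))) (cong (c * f 0 +_) (∑-*ˡ n c (f ∘ suc)))

∑-*ʳ : ∀ n c f → ∑ n f * c ≡ ∑ n (λ i → f i * c)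
∑-*ʳ n c f = trans (QP.*-comm (∑ n f) c) (trans (∑-*ˡ n c f) (∑-cong n (λ i _ → QP.*-comm c (f i))))

∑-minus : ∀ n f g → ∑ n (λ i → f i - g i) ≡ ∑ n f - ∑ n g
∑-minus zero    f g = sym (QP.+-inverseʳ 0ℚ)
∑-minus (suc n) f g = trans (cong ((f 0 - g 0) +_) (∑-minus n (f ∘ suc) (g ∘ suc)))
                        (interchange (f 0) (g 0) (∑ n (f ∘ suc)) (∑ n (g ∘ suc)))
  where
  interchange : ∀ a b c d → (a - b) + (c - d) ≡ (a + c) - (b + d)
  interchange = solve-∀ ℚ-ring

∑-drop-last : ∀ n f → f n ≡ 0ℚ → ∑ (suc n) f ≡ ∑ n f
∑-drop-last n f fn≡0 = trans (∑-snoc n f) (trans (cong (∑ n f +_) fn≡0) (QP.+-identityʳ _))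

∑-reverse : ∀ n f → ∑ n f ≡ ∑ n (λ k → f (n ∸ suc k))
∑-reverse zero    f = refl
∑-reverse (suc n) f = begin
  f 0 + ∑ n (f ∘ suc)                                 ≡⟨ cong (f 0 +_) (∑-reverse n (f ∘ suc)) ⟩
  f 0 + ∑ n (λ k → f (suc (n ∸ suc k)))               ≡⟨ QP.+-comm (f 0) _ ⟩
  ∑ n (λ k → f (suc (n ∸ suc k))) + f 0               ≡⟨ cong₂ _+_ (∑-cong n (λ k k<n → cong f (sym (NP.+-∸-assoc 1 k<n))))
                                                                   (cong f (sym (NP.n∸n≡0 n))) ⟩
  ∑ n (λ k → f (suc n ∸ suc k)) + f (suc n ∸ suc n)   ≡⟨ sym (∑-snoc n (λ k → f (suc n ∸ suc k))) ⟩
  ∑ (suc n) (λ k → f (suc n ∸ suc k))                 ∎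
  where open ≡-Reasoning

∑-extend : ∀ n m f → (∀ i → f (n ℕ.+ i) ≡ 0ℚ) → ∑ (n ℕ.+ m) f ≡ ∑ n f
∑-extend zero    m f f≡0 = ∑-zero m f f≡0
∑-extend (suc n) m f f≡0 = cong (f 0 +_) (∑-extend n m (f ∘ suc) f≡0)

∑-triangle : ∀ h (G : ℕ → ℕ → ℚ) →
  ∑ (suc h) (λ m → ∑ (suc m) (λ k → G k (m ∸ k))) ≡ ∑ (suc h) (λ k → ∑ (suc (h ∸ k)) (G k))
∑-triangle zero    G = refl
∑-triangle (suc h) G = begin
  ∑ (suc (suc h)) row                                            ≡⟨ ∑-snoc (suc h) row ⟩
  ∑ (suc h) row + row (suc h)                                    ≡⟨ cong₂ _+_ (∑-triangle h G) (∑-snoc (suc h) diagonal) ⟩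
  ∑ (suc h) column + (∑ (suc h) diagonal + G (suc h) (suc h ∸ suc h))
                                                                 ≡⟨ cong (λ i → ∑ (suc h) column + (∑ (suc h) diagonal + G (suc h) i)) (NP.n∸n≡0 h) ⟩
  ∑ (suc h) column + (∑ (suc h) diagonal + G (suc h) 0)          ≡⟨ QP.+-assoc (∑ (suc h) column) (∑ (suc h) diagonal) (G (suc h) 0) ⟨
  (∑ (suc h) column + ∑ (suc h) diagonal) + G (suc h) 0          ≡⟨ cong₂ _+_ (sym (∑-+ (suc h) column diagonal)) (sym (QP.+-identityʳ _)) ⟩
  ∑ (suc h) (λ k → column k + diagonal k) + ∑ 1 (G (suc h))     ≡⟨ cong₂ _+_ (∑-cong (suc h) longer-column) (cong (λ i → ∑ (suc i) (G (suc h))) (sym (NP.n∸n≡0 h))) ⟩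
  ∑ (suc h) column′ + column′ (suc h)                            ≡⟨ ∑-snoc (suc h) column′ ⟨
  ∑ (suc (suc h)) column′                                        ∎
  where
  open ≡-Reasoning
  row = λ m → ∑ (suc m) (λ k → G k (m ∸ k))
  column = λ k → ∑ (suc (h ∸ k)) (G k)
  column′ = λ k → ∑ (suc (suc h ∸ k)) (G k)
  diagonal = λ k → G k (suc h ∸ k)
  longer-column : ∀ k → k < suc h → column k + diagonal k ≡ column′ k
  longer-column k (s≤s k≤h) = begin
    column k + G k (suc h ∸ k)        ≡⟨ cong (λ i → column k + G k i) (NP.+-∸-assoc 1 k≤h) ⟩
    column k + G k (suc (h ∸ k))      ≡⟨ ∑-snoc (suc (h ∸ k)) (G k) ⟨
    ∑ (suc (suc (h ∸ k))) (G k)       ≡⟨ cong (λ i → ∑ (suc i) (G k)) (NP.+-∸-assoc 1 k≤h) ⟨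
    column′ k                         ∎

sgn-suc : ∀ m → sgn (suc m) ≡ - sgn m
sgn-suc m = neg-1* (sgn m)
  where
  neg-1* : ∀ x → (- 1ℚ) * x ≡ - x
  neg-1* = solve-∀ ℚ-ring

sgn-+ : ∀ a b → sgn (a ℕ.+ b) ≡ sgn a * sgn b
sgn-+ zero    b = sym (QP.*-identityˡ (sgn b))
sgn-+ (suc a) b = trans (cong ((- 1ℚ) *_) (sgn-+ a b)) (sym (QP.*-assoc (- 1ℚ) (sgn a) (sgn b)))

sgn-square : ∀ k → sgn k * sgn k ≡ 1ℚ
sgn-square zero    = refl
sgn-square (suc k) = trans (neg-square (sgn k)) (sgn-square k)
  where
  neg-square : ∀ x → ((- 1ℚ) * x) * ((- 1ℚ) * x) ≡ x * x
  neg-square = solve-∀ ℚ-ring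

sgn≢0 : ∀ k → sgn k ≢ 0ℚ
sgn≢0 k eq = ι-suc≢0 0 (trans ι-1 (trans (sym (sgn-square k)) (trans (cong (_* sgn k) eq) (QP.*-zeroˡ (sgn k)))))

poch-suc : ∀ a k → poch a (suc k) ≡ poch a k * (a + ι k)
poch-suc a k = cong (λ x → poch a k * (a + x)) (sym (ι≡⟦⟧ k))

poch-negate : ∀ t k → poch (- ι (t ℕ.+ k)) k * ι (t !) ≡ sgn k * ι ((t ℕ.+ k) !)
poch-negate t zero = trans (QP.*-identityˡ _) (trans (cong (λ i → ι (i !)) (sym (NP.+-identityʳ t))) (sym (QP.*-identityˡ _)))
poch-negate t (suc k) = begin
  poch (- ι (t ℕ.+ suc k)) (suc k) * ι (t !)                ≡⟨ cong (_* ι (t !)) (poch-suc (- ι (t ℕ.+ suc k)) k) ⟩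
  poch (- ι (t ℕ.+ suc k)) k * (- ι (t ℕ.+ suc k) + ι k) * ι (t !)
                                                            ≡⟨ cong (λ i → poch (- ι i) k * (- ι i + ι k) * ι (t !)) (NP.+-suc t k) ⟩
  P * (- ι (suc t ℕ.+ k) + ι k) * ι (t !)                   ≡⟨ cong (λ x → P * (- x + ι k) * ι (t !)) (ι-+ (suc t) k) ⟩
  P * (- (ι (suc t) + ι k) + ι k) * ι (t !)                 ≡⟨ cancel P (ι (suc t)) (ι k) (ι (t !)) ⟩
  - (P * (ι (suc t) * ι (t !)))                             ≡⟨ cong (λ x → - (P * x)) (sym (ι-suc-! t)) ⟩
  - (P * ι (suc t !))                                       ≡⟨ cong -_ (poch-negate (suc t) k) ⟩
  - (sgn k * ι ((suc t ℕ.+ k) !))                           ≡⟨ negate (sgn k) (ι ((suc t ℕ.+ k) !)) ⟩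
  sgn (suc k) * ι ((suc t ℕ.+ k) !)                         ≡⟨ cong (λ i → sgn (suc k) * ι (i !)) (sym (NP.+-suc t k)) ⟩
  sgn (suc k) * ι ((t ℕ.+ suc k) !)                         ∎
  where
  open ≡-Reasoning
  P = poch (- ι (suc t ℕ.+ k)) k
  cancel : ∀ p a b c → p * (- (a + b) + b) * c ≡ - (p * (a * c))
  cancel = solve-∀ ℚ-ring
  negate : ∀ s x → - (s * x) ≡ (- 1ℚ) * s * x
  negate = solve-∀ ℚ-ring

poch-ι-suc : ∀ t k → poch (ι (suc t)) k * ι (t !) ≡ ι ((t ℕ.+ k) !)
poch-ι-suc t zero = trans (QP.*-identityˡ _) (cong (λ i → ι (i !)) (sym (NP.+-identityʳ t)))
poch-ι-suc t (suc k) = begin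
  poch (ι (suc t)) (suc k) * ι (t !)                    ≡⟨ cong (_* ι (t !)) (poch-suc (ι (suc t)) k) ⟩
  poch (ι (suc t)) k * (ι (suc t) + ι k) * ι (t !)      ≡⟨ swap₂₃ (poch (ι (suc t)) k) (ι (suc t) + ι k) (ι (t !)) ⟩
  poch (ι (suc t)) k * ι (t !) * (ι (suc t) + ι k)      ≡⟨ cong₂ _*_ (poch-ι-suc t k) (sym (ι-+ (suc t) k)) ⟩
  ι ((t ℕ.+ k) !) * ι (suc t ℕ.+ k)                     ≡⟨ QP.*-comm (ι ((t ℕ.+ k) !)) (ι (suc t ℕ.+ k)) ⟩
  ι (suc (t ℕ.+ k)) * ι ((t ℕ.+ k) !)                   ≡⟨ ι-suc-! (t ℕ.+ k) ⟨
  ι (suc (t ℕ.+ k) !)                                   ≡⟨ cong (λ i → ι (i !)) (sym (NP.+-suc t k)) ⟩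
  ι ((t ℕ.+ suc k) !)                                   ∎
  where
  open ≡-Reasoning
  swap₂₃ : ∀ p a c → p * a * c ≡ p * c * a
  swap₂₃ = solve-∀ ℚ-ring

poch-ι : ∀ R k → poch (ι R) k * ι (R !) * ι (R ℕ.+ k) ≡ ι ((R ℕ.+ k) !) * ι R
poch-ι R zero = trans (cong (λ i → 1ℚ * ι (R !) * ι i) (NP.+-identityʳ R))
                  (trans (cong (_* ι R) (QP.*-identityˡ (ι (R !)))) (cong (λ i → ι (i !) * ι R) (sym (NP.+-identityʳ R))))
poch-ι R (suc k) = begin
  poch (ι R) (suc k) * ι (R !) * ι (R ℕ.+ suc k)               ≡⟨ cong (λ x → x * ι (R !) * ι (R ℕ.+ suc k)) (poch-suc (ι R) k) ⟩
  poch (ι R) k * (ι R + ι k) * ι (R !) * ι (R ℕ.+ suc k)       ≡⟨ cong₂ (λ x y → poch (ι R) k * x * ι (R !) * y) (sym (ι-+ R k)) (cong ι (NP.+-suc R k)) ⟩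
  poch (ι R) k * ι (R ℕ.+ k) * ι (R !) * ι (suc (R ℕ.+ k))     ≡⟨ swap₂₃ (poch (ι R) k) (ι (R ℕ.+ k)) (ι (R !)) (ι (suc (R ℕ.+ k))) ⟩
  poch (ι R) k * ι (R !) * ι (R ℕ.+ k) * ι (suc (R ℕ.+ k))     ≡⟨ cong (_* ι (suc (R ℕ.+ k))) (poch-ι R k) ⟩
  ι ((R ℕ.+ k) !) * ι R * ι (suc (R ℕ.+ k))                    ≡⟨ rotate (ι ((R ℕ.+ k) !)) (ι R) (ι (suc (R ℕ.+ k))) ⟩
  ι (suc (R ℕ.+ k)) * ι ((R ℕ.+ k) !) * ι R                    ≡⟨ cong (_* ι R) (ι-suc-! (R ℕ.+ k)) ⟨
  ι (suc (R ℕ.+ k) !) * ι R                                    ≡⟨ cong (λ i → ι (i !) * ι R) (sym (NP.+-suc R k)) ⟩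
  ι ((R ℕ.+ suc k) !) * ι R                                    ∎
  where
  open ≡-Reasoning
  swap₂₃ : ∀ p x f y → p * x * f * y ≡ p * f * x * y
  swap₂₃ = solve-∀ ℚ-ring
  rotate : ∀ f r y → f * r * y ≡ y * f * r
  rotate = solve-∀ ℚ-ring

C-factorial : ∀ p q → ι ((p ℕ.+ q) C p) * ι (p !) * ι (q !) ≡ ι ((p ℕ.+ q) !)
C-factorial p q = begin
  ι (n C p) * ι (p !) * ι (q !)            ≡⟨ QP.*-assoc (ι (n C p)) (ι (p !)) (ι (q !)) ⟩
  ι (n C p) * (ι (p !) * ι (q !))          ≡⟨ trans (ι-* (n C p) (p ! ℕ.* q !)) (cong (ι (n C p) *_) (ι-* (p !) (q !))) ⟨
  ι ((n C p) ℕ.* (p ! ℕ.* q !))              ≡⟨ cong (λ i → ι ((n C p) ℕ.* (p ! ℕ.* i !))) (sym (NP.m+n∸m≡n p q)) ⟩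
  ι ((n C p) ℕ.* (p ! ℕ.* (n ∸ p) !))        ≡⟨ cong ι (C-factorialℕ (NP.m≤m+n p q)) ⟩
  ι (n !)                                  ∎
  where
  open ≡-Reasoning
  n = p ℕ.+ q
  C-factorialℕ : ∀ {n k} → k ≤ n → (n C k) ℕ.* (k ! ℕ.* (n ∸ k) !) ≡ n !
  C-factorialℕ {n} {k} k≤n = trans (cong (ℕ._* (k ! ℕ.* (n ∸ k) !)) (Comb.nCk≡n!/k![n-k]! k≤n))
                                   (DM.m/n*n≡m {{NP._!*_!≢0 k (n ∸ k)}} (Comb.k![n∸k]!∣n! k≤n))

-- Signed ballot numbers against Fibonacci numbers

-- C(n, l - 1), with C(n, -1) = 0
C-pred : ℕ → ℕ → ℕ
C-pred n zero    = 0
C-pred n (suc l) = n C l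

ballot : ℕ → ℕ → ℚ
ballot n l = sgn l * (ι (n C l) - ι (C-pred n l))

fibℚ : ℕ → ℚ
fibℚ n = ι (fib n)

ballotFib : ℕ → ℕ → ℚ
ballotFib n h = ∑ (suc h) (λ l → ballot n l * fibℚ (n ∸ 2 ℕ.* l ℕ.+ 1))

fibℚ-suc-suc : ∀ n → fibℚ (suc (suc n)) ≡ fibℚ (suc n) + fibℚ n
fibℚ-suc-suc n = ι-+ (fib (suc n)) (fib n)

ballot-0 : ∀ n → ballot n 0 ≡ 1ℚ
ballot-0 n = cong₂ (λ a b → 1ℚ * (a - b)) ι-1 ι-0

ballot-suc : ∀ n l → ballot (suc n) (suc l) ≡ ballot n (suc l) - ballot n l
ballot-suc n l = begin
  sgn (suc l) * (ι (suc n C suc l) - ι (suc n C l))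
      ≡⟨ cong₂ (λ a b → sgn (suc l) * (a - b)) (pascal (suc l)) (pascal l) ⟩
  sgn (suc l) * ((ι (n C l) + ι (n C suc l)) - (ι (C-pred n l) + ι (n C l)))
      ≡⟨ cong (_* ((ι (n C l) + ι (n C suc l)) - (ι (C-pred n l) + ι (n C l)))) (sgn-suc l) ⟩
  - sgn l * ((ι (n C l) + ι (n C suc l)) - (ι (C-pred n l) + ι (n C l)))
      ≡⟨ regroup (sgn l) (ι (n C l)) (ι (n C suc l)) (ι (C-pred n l)) ⟩
  - sgn l * (ι (n C suc l) - ι (n C l)) - sgn l * (ι (n C l) - ι (C-pred n l))
      ≡⟨ cong (λ s → s * (ι (n C suc l) - ι (n C l)) - ballot n l) (sym (sgn-suc l)) ⟩
  ballot n (suc l) - ballot n l ∎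
  where
  open ≡-Reasoning
  pascal : ∀ l → ι (suc n C l) ≡ ι (C-pred n l) + ι (n C l)
  pascal zero    = sym (trans (cong (_+ ι 1) ι-0) (QP.+-identityˡ (ι 1)))
  pascal (suc l) = trans (cong ι (sym (Comb.nCk+nC[k+1]≡[n+1]C[k+1] n l))) (ι-+ (n C l) (n C suc l))
  regroup : ∀ s a b c → - s * ((a + b) - (c + a)) ≡ - s * (b - a) - s * (a - c)
  regroup = solve-∀ ℚ-ring

ballot-middle : ∀ p → ballot (suc (2 ℕ.* p)) (suc p) ≡ 0ℚ
ballot-middle p = begin
  sgn (suc p) * (ι (n C suc p) - ι (n C p))         ≡⟨ cong (λ c → sgn (suc p) * (ι (n C suc p) - ι c)) symmetric ⟩
  sgn (suc p) * (ι (n C suc p) - ι (n C suc p))     ≡⟨ x*[y-y]≡0 (sgn (suc p)) (ι (n C suc p)) ⟩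
  0ℚ                                                ∎
  where
  open ≡-Reasoning
  n = suc (2 ℕ.* p)
  n∸p≡1+p : n ∸ p ≡ suc p
  n∸p≡1+p = trans (cong (_∸ p) (sym (NP.+-suc p (p ℕ.+ 0))))
                  (trans (NP.m+n∸m≡n p (suc (p ℕ.+ 0))) (cong suc (NP.+-identityʳ p)))
  symmetric : n C p ≡ n C suc p
  symmetric = trans (Comb.nCk≡nC[n∸k] (NP.≤-trans (NP.m≤m+n p (p ℕ.+ 0)) (NP.n≤1+n _))) (cong (n C_) n∸p≡1+p)
  x*[y-y]≡0 : ∀ x y → x * (y - y) ≡ 0ℚ
  x*[y-y]≡0 = solve-∀ ℚ-ring

m∸n≡1+m∸[1+n] : ∀ {m n} → n < m → m ∸ n ≡ suc (m ∸ suc n)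
m∸n≡1+m∸[1+n] {suc m} {zero}  _         = refl
m∸n≡1+m∸[1+n] {suc m} {suc n} (s≤s n<m) = m∸n≡1+m∸[1+n] n<m

ballotFib-suc : ∀ n h → 2 ℕ.* h ≤ n → ballotFib (suc n) h ≡ ballotFib n h + ballot n h * fibℚ (n ∸ 2 ℕ.* h)
ballotFib-suc n zero _ = begin
  ballot (suc n) 0 * fibℚ (suc n ℕ.+ 1) + 0ℚ      ≡⟨ cong₂ (λ b i → b * fibℚ i + 0ℚ) (ballot-0 (suc n)) (NP.+-comm (suc n) 1) ⟩
  1ℚ * fibℚ (suc (suc n)) + 0ℚ                    ≡⟨ cong (λ x → 1ℚ * x + 0ℚ) (fibℚ-suc-suc n) ⟩
  1ℚ * (fibℚ (suc n) + fibℚ n) + 0ℚ               ≡⟨ split (fibℚ (suc n)) (fibℚ n) ⟩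
  (1ℚ * fibℚ (suc n) + 0ℚ) + 1ℚ * fibℚ n          ≡⟨ cong₂ (λ b i → (b * fibℚ i + 0ℚ) + b * fibℚ n) (sym (ballot-0 n)) (NP.+-comm 1 n) ⟩
  (ballot n 0 * fibℚ (n ℕ.+ 1) + 0ℚ) + ballot n 0 * fibℚ n ∎
  where
  open ≡-Reasoning
  split : ∀ a b → 1ℚ * (a + b) + 0ℚ ≡ (1ℚ * a + 0ℚ) + 1ℚ * b
  split = solve-∀ ℚ-ring
ballotFib-suc n (suc h) 2h+2≤n = begin
  ballotFib (suc n) (suc h)
      ≡⟨ ∑-snoc (suc h) (λ l → ballot (suc n) l * fibℚ (suc n ∸ 2 ℕ.* l ℕ.+ 1)) ⟩
  ballotFib (suc n) h + ballot (suc n) (suc h) * fibℚ (suc n ∸ 2 ℕ.* suc h ℕ.+ 1)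
      ≡⟨ cong₂ _+_ (trans (ballotFib-suc n h 2h≤n) (cong (λ i → ballotFib n h + ballot n h * fibℚ i) n-2h≡e+2))
                   (cong₂ _*_ (ballot-suc n h) (cong fibℚ n+1-2h-2+1≡e+2)) ⟩
  (ballotFib n h + ballot n h * fibℚ (suc (suc e))) + (ballot n (suc h) - ballot n h) * fibℚ (suc (suc e))
      ≡⟨ cong (λ x → (ballotFib n h + ballot n h * x) + (ballot n (suc h) - ballot n h) * x) (fibℚ-suc-suc e) ⟩
  (ballotFib n h + ballot n h * (fibℚ (suc e) + fibℚ e)) + (ballot n (suc h) - ballot n h) * (fibℚ (suc e) + fibℚ e)
      ≡⟨ telescope (ballotFib n h) (ballot n h) (ballot n (suc h)) (fibℚ (suc e)) (fibℚ e) ⟩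
  (ballotFib n h + ballot n (suc h) * fibℚ (suc e)) + ballot n (suc h) * fibℚ e
      ≡⟨ cong (λ i → (ballotFib n h + ballot n (suc h) * fibℚ i) + ballot n (suc h) * fibℚ e) (NP.+-comm 1 e) ⟩
  (ballotFib n h + ballot n (suc h) * fibℚ (e ℕ.+ 1)) + ballot n (suc h) * fibℚ e
      ≡⟨ cong (_+ ballot n (suc h) * fibℚ e) (∑-snoc (suc h) (λ l → ballot n l * fibℚ (n ∸ 2 ℕ.* l ℕ.+ 1))) ⟨
  ballotFib n (suc h) + ballot n (suc h) * fibℚ e ∎
  where
  open ≡-Reasoning
  e = n ∸ 2 ℕ.* suc h
  2+2h≤n : suc (suc (2 ℕ.* h)) ≤ n
  2+2h≤n = subst (_≤ n) (NP.*-suc 2 h) 2h+2≤n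
  2h≤n : 2 ℕ.* h ≤ n
  2h≤n = NP.≤-trans (NP.m≤n+m (2 ℕ.* h) 2) 2+2h≤n
  n-2h≡e+2 : n ∸ 2 ℕ.* h ≡ suc (suc e)
  n-2h≡e+2 = trans (m∸n≡1+m∸[1+n] (NP.≤-trans (NP.n≤1+n _) 2+2h≤n))
                   (cong suc (trans (m∸n≡1+m∸[1+n] 2+2h≤n) (cong (λ i → suc (n ∸ i)) (sym (NP.*-suc 2 h)))))
  n+1-2h-2+1≡e+2 : suc n ∸ 2 ℕ.* suc h ℕ.+ 1 ≡ suc (suc e)
  n+1-2h-2+1≡e+2 = trans (cong (ℕ._+ 1) (NP.+-∸-assoc 1 2h+2≤n)) (NP.+-comm (suc e) 1)
  telescope : ∀ b x y f₁ f₀ → (b + x * (f₁ + f₀)) + (y - x) * (f₁ + f₀) ≡ (b + y * f₁) + y * f₀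
  telescope = solve-∀ ℚ-ring

ballotFib-even : ∀ p → ballotFib (2 ℕ.* p) p ≡ 1ℚ
ballotFib-odd  : ∀ p → ballotFib (suc (2 ℕ.* p)) p ≡ 1ℚ

ballotFib-even zero    = cong₂ (λ b f → b * f + 0ℚ) (ballot-0 0) ι-1
ballotFib-even (suc p) = begin
  ballotFib (2 ℕ.* suc p) (suc p)
      ≡⟨ cong (λ i → ballotFib i (suc p)) (NP.*-suc 2 p) ⟩
  ballotFib (suc n) (suc p)
      ≡⟨ ∑-snoc (suc p) (λ l → ballot (suc n) l * fibℚ (suc n ∸ 2 ℕ.* l ℕ.+ 1)) ⟩
  ballotFib (suc n) p + ballot (suc n) (suc p) * fibℚ (suc n ∸ 2 ℕ.* suc p ℕ.+ 1)
      ≡⟨ cong₂ _+_ (ballotFib-suc n p (NP.n≤1+n _)) (cong₂ _*_ (ballot-suc n p) (cong fibℚ last-index)) ⟩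
  (ballotFib n p + ballot n p * fibℚ (n ∸ 2 ℕ.* p)) + (ballot n (suc p) - ballot n p) * fibℚ 1
      ≡⟨ cong₂ (λ b i → (b + ballot n p * fibℚ i) + (ballot n (suc p) - ballot n p) * fibℚ 1)
               (ballotFib-odd p) (trans (NP.+-∸-assoc 1 (NP.≤-refl {2 ℕ.* p})) (cong suc (NP.n∸n≡0 (2 ℕ.* p)))) ⟩
  (1ℚ + ballot n p * fibℚ 1) + (ballot n (suc p) - ballot n p) * fibℚ 1
      ≡⟨ cong₂ (λ f b → (1ℚ + ballot n p * f) + (b - ballot n p) * f) ι-1 (ballot-middle p) ⟩
  (1ℚ + ballot n p * 1ℚ) + (0ℚ - ballot n p) * 1ℚ
      ≡⟨ cancel (ballot n p) ⟩
  1ℚ ∎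
  where
  open ≡-Reasoning
  n = suc (2 ℕ.* p)
  last-index : suc n ∸ 2 ℕ.* suc p ℕ.+ 1 ≡ 1
  last-index = trans (cong (λ i → suc n ∸ i ℕ.+ 1) (NP.*-suc 2 p)) (cong (ℕ._+ 1) (NP.n∸n≡0 (2 ℕ.* p)))
  cancel : ∀ x → (1ℚ + x * 1ℚ) + (0ℚ - x) * 1ℚ ≡ 1ℚ
  cancel = solve-∀ ℚ-ring

ballotFib-odd p = begin
  ballotFib (suc (2 ℕ.* p)) p                                     ≡⟨ ballotFib-suc (2 ℕ.* p) p NP.≤-refl ⟩
  ballotFib (2 ℕ.* p) p + ballot (2 ℕ.* p) p * fibℚ (2 ℕ.* p ∸ 2 ℕ.* p)
                                                                   ≡⟨ cong₂ (λ b i → b + ballot (2 ℕ.* p) p * fibℚ i) (ballotFib-even p) (NP.n∸n≡0 (2 ℕ.* p)) ⟩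
  1ℚ + ballot (2 ℕ.* p) p * fibℚ 0                                ≡⟨ cong (λ f → 1ℚ + ballot (2 ℕ.* p) p * f) ι-0 ⟩
  1ℚ + ballot (2 ℕ.* p) p * 0ℚ                                    ≡⟨ cancel (ballot (2 ℕ.* p) p) ⟩
  1ℚ                                                              ∎
  where
  open ≡-Reasoning
  cancel : ∀ x → 1ℚ + x * 0ℚ ≡ 1ℚ
  cancel = solve-∀ ℚ-ring

data Parity : ℕ → Set where
  even : ∀ p → Parity (2 ℕ.* p)
  odd  : ∀ p → Parity (suc (2 ℕ.* p))

parity : ∀ n → Parity n
parity zero = even 0
parity (suc n) with parity n
... | even p = odd p
... | odd  p = subst Parity (NP.*-suc 2 p) (even (suc p))

ballotFib-half : ∀ n → ballotFib n (n ℕ./ 2) ≡ 1ℚ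
ballotFib-half n with parity n
... | even p = trans (cong (ballotFib (2 ℕ.* p)) (2p/2≡p p)) (ballotFib-even p)
  where
  2p/2≡p : ∀ p → 2 ℕ.* p ℕ./ 2 ≡ p
  2p/2≡p p = trans (cong (ℕ._/ 2) (NP.*-comm 2 p)) (DM.m*n/n≡m p 2)
... | odd  p = trans (cong (ballotFib (suc (2 ℕ.* p))) 1+2p/2≡p) (ballotFib-odd p)
  where
  1+2p/2≡p : suc (2 ℕ.* p) ℕ./ 2 ≡ p
  1+2p/2≡p = trans (DM.+-distrib-/-∣ʳ 1 (divides p (NP.*-comm 2 p)))
                   (trans (cong (ℕ._/ 2) (NP.*-comm 2 p)) (DM.m*n/n≡m p 2))

2*[n/2]≤n : ∀ n → 2 ℕ.* (n ℕ./ 2) ≤ n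
2*[n/2]≤n n = subst (_≤ n) (NP.*-comm (n ℕ./ 2) 2) (DM.m/n*n≤m n 2)

n<2*[1+n/2] : ∀ n → n < 2 ℕ.* suc (n ℕ./ 2)
n<2*[1+n/2] n = NP.≤-trans (NP.≤-reflexive (cong suc (DM.m≡m%n+[m/n]*n n 2)))
                (NP.≤-trans (NP.+-monoˡ-≤ ((n ℕ./ 2) ℕ.* 2) (DM.m%n<n n 2))
                (NP.≤-reflexive (2+x*2≡2*[1+x] (n ℕ./ 2))))
  where
  2+x*2≡2*[1+x] : ∀ x → 2 ℕ.+ x ℕ.* 2 ≡ 2 ℕ.* suc x
  2+x*2≡2*[1+x] = ℕ-Solver.solve-∀

∑-up-to-half : ∀ j f → (∀ k → j < 2 ℕ.* k → f k ≡ 0ℚ) → ∑ (suc (j ℕ./ 2)) f ≡ ∑ (suc j) f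
∑-up-to-half j f vanish = begin
  ∑ (suc h) f                  ≡⟨ ∑-extend (suc h) (j ∸ h) f (λ i → vanish (suc h ℕ.+ i) (j<2[1+h+i] i)) ⟨
  ∑ (suc h ℕ.+ (j ∸ h)) f      ≡⟨ cong (λ n → ∑ (suc n) f) (NP.m+[n∸m]≡n (DM.m/n≤m j 2)) ⟩
  ∑ (suc j) f                  ∎
  where
  open ≡-Reasoning
  h = j ℕ./ 2
  j<2[1+h+i] : ∀ i → j < 2 ℕ.* (suc h ℕ.+ i)
  j<2[1+h+i] i = NP.<-≤-trans (n<2*[1+n/2] j) (NP.*-monoʳ-≤ 2 (NP.m≤m+n (suc h) i))

-- Chebyshev polynomials at x = 1

-- The coefficient in U j x = ∑ₖ (-1)ᵏ C(j - k, k) (2x)^(j - 2k), at x = 1.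
chebU : ℕ → ℕ → ℚ
chebU j k = sgn k * ι (2 ℕ.^ (j ∸ 2 ℕ.* k)) * ι ((j ∸ k) C k)

chebU-vanish : ∀ j k → j < 2 ℕ.* k → chebU j k ≡ 0ℚ
chebU-vanish j k j<2k = trans (cong (sgn k * ι (2 ℕ.^ (j ∸ 2 ℕ.* k)) *_) (trans (cong ι (Comb.k>n⇒nCk≡0 (j∸k<k j k j<2k))) ι-0))
                              (QP.*-zeroʳ (sgn k * ι (2 ℕ.^ (j ∸ 2 ℕ.* k))))
  where
  j∸k<k : ∀ j k → j < 2 ℕ.* k → j ∸ k < k
  j∸k<k j zero ()
  j∸k<k j (suc k) j<2k with NP.≤-total (suc k) j
  ... | inj₁ k<j = NP.+-cancelʳ-< (suc k) (j ∸ suc k) (suc k)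
                     (subst (_< suc k ℕ.+ suc k) (sym (NP.m∸n+n≡m k<j))
                       (subst (j <_) (cong (suc k ℕ.+_) (NP.+-identityʳ (suc k))) j<2k))
  ... | inj₂ j≤k = subst (_< suc k) (sym (NP.m≤n⇒m∸n≡0 j≤k)) (s≤s z≤n)

ι-2^suc : ∀ e → ι (2 ℕ.^ suc e) ≡ ι 2 * ι (2 ℕ.^ e)
ι-2^suc e = ι-* 2 (2 ℕ.^ e)

chebU-suc : ∀ j k → chebU (suc j) (suc k) ≡ sgn (suc k) * ι (2 ℕ.^ (j ∸ suc (2 ℕ.* k))) * ι ((j ∸ k) C suc k)
chebU-suc j k = cong (λ i → sgn (suc k) * ι (2 ℕ.^ (suc j ∸ i)) * ι ((j ∸ k) C suc k)) (NP.*-suc 2 k)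

chebU-suc-suc : ∀ j k → chebU (suc (suc j)) (suc k) ≡ sgn (suc k) * ι (2 ℕ.^ (j ∸ 2 ℕ.* k)) * ι ((suc j ∸ k) C suc k)
chebU-suc-suc j k = cong (λ i → sgn (suc k) * ι (2 ℕ.^ (suc (suc j) ∸ i)) * ι ((suc j ∸ k) C suc k)) (NP.*-suc 2 k)

chebU-rec : ∀ j k → chebU (suc (suc j)) (suc k) ≡ ι 2 * chebU (suc j) (suc k) - chebU j k
chebU-rec j k with NP.<-cmp (2 ℕ.* k) j
... | tri< 2k<j _ _ = begin
  chebU (suc (suc j)) (suc k)
      ≡⟨ chebU-suc-suc j k ⟩
  sgn (suc k) * ι (2 ℕ.^ (j ∸ 2 ℕ.* k)) * ι ((suc j ∸ k) C suc k)
      ≡⟨ cong₂ (λ a b → sgn (suc k) * ι (2 ℕ.^ a) * ι (b C suc k)) j-2k≡1+e (NP.+-∸-assoc 1 k≤j) ⟩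
  sgn (suc k) * ι (2 ℕ.^ suc e) * ι (suc (j ∸ k) C suc k)
      ≡⟨ cong₂ (λ a b → a * ι (2 ℕ.^ suc e) * b) (sgn-suc k) pascal ⟩
  - sgn k * ι (2 ℕ.^ suc e) * (ι ((j ∸ k) C k) + ι ((j ∸ k) C suc k))
      ≡⟨ cong (λ x → - sgn k * x * (ι ((j ∸ k) C k) + ι ((j ∸ k) C suc k))) (ι-2^suc e) ⟩
  - sgn k * (ι 2 * ι (2 ℕ.^ e)) * (ι ((j ∸ k) C k) + ι ((j ∸ k) C suc k))
      ≡⟨ distribute (sgn k) (ι 2) (ι (2 ℕ.^ e)) (ι ((j ∸ k) C k)) (ι ((j ∸ k) C suc k)) ⟩
  ι 2 * (- sgn k * ι (2 ℕ.^ e) * ι ((j ∸ k) C suc k)) - sgn k * (ι 2 * ι (2 ℕ.^ e)) * ι ((j ∸ k) C k)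
      ≡⟨ cong₂ (λ a b → ι 2 * (a * ι (2 ℕ.^ e) * ι ((j ∸ k) C suc k)) - sgn k * b * ι ((j ∸ k) C k))
               (sym (sgn-suc k)) (sym (trans (cong (λ i → ι (2 ℕ.^ i)) j-2k≡1+e) (ι-2^suc e))) ⟩
  ι 2 * (sgn (suc k) * ι (2 ℕ.^ e) * ι ((j ∸ k) C suc k)) - chebU j k
      ≡⟨ cong (λ x → ι 2 * x - chebU j k) (chebU-suc j k) ⟨
  ι 2 * chebU (suc j) (suc k) - chebU j k ∎
  where
  open ≡-Reasoning
  e = j ∸ suc (2 ℕ.* k)
  j-2k≡1+e : j ∸ 2 ℕ.* k ≡ suc e
  j-2k≡1+e = m∸n≡1+m∸[1+n] 2k<j
  k≤j : k ≤ j
  k≤j = NP.≤-trans (NP.m≤m+n k (k ℕ.+ 0)) (NP.<⇒≤ 2k<j)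
  pascal : ι (suc (j ∸ k) C suc k) ≡ ι ((j ∸ k) C k) + ι ((j ∸ k) C suc k)
  pascal = trans (cong ι (sym (Comb.nCk+nC[k+1]≡[n+1]C[k+1] (j ∸ k) k))) (ι-+ _ _)
  distribute : ∀ s t p a b → - s * (t * p) * (a + b) ≡ t * (- s * p * b) - s * (t * p) * a
  distribute = solve-∀ ℚ-ring
... | tri≈ _ refl _ = begin
  chebU (suc (suc j)) (suc k)
      ≡⟨ chebU-suc-suc j k ⟩
  sgn (suc k) * ι (2 ℕ.^ (j ∸ j)) * ι ((suc j ∸ k) C suc k)
      ≡⟨ cong₂ (λ a b → sgn (suc k) * ι (2 ℕ.^ a) * ι b) (NP.n∸n≡0 j)
               (trans (cong (_C suc k) (trans (NP.+-∸-assoc 1 k≤j) (cong suc 2k∸k≡k))) (Comb.nCn≡1 (suc k))) ⟩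
  sgn (suc k) * ι 1 * ι 1
      ≡⟨ cong (λ s → s * ι 1 * ι 1) (sgn-suc k) ⟩
  - sgn k * ι 1 * ι 1
      ≡⟨ negate (ι 2) (sgn k) (ι 1) ⟩
  ι 2 * 0ℚ - sgn k * ι 1 * ι 1
      ≡⟨ cong₂ (λ a b → ι 2 * a - sgn k * ι (2 ℕ.^ b) * ι 1)
               (sym (chebU-vanish (suc j) (suc k) (subst (suc j <_) (sym (NP.*-suc 2 k)) (NP.n<1+n _))))
               (sym (NP.n∸n≡0 j)) ⟩
  ι 2 * chebU (suc j) (suc k) - sgn k * ι (2 ℕ.^ (j ∸ j)) * ι 1
      ≡⟨ cong (λ b → ι 2 * chebU (suc j) (suc k) - sgn k * ι (2 ℕ.^ (j ∸ j)) * ι b)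
              (sym (trans (cong (_C k) 2k∸k≡k) (Comb.nCn≡1 k))) ⟩
  ι 2 * chebU (suc j) (suc k) - chebU j k ∎
  where
  open ≡-Reasoning
  k≤j : k ≤ 2 ℕ.* k
  k≤j = NP.m≤m+n k (k ℕ.+ 0)
  2k∸k≡k : 2 ℕ.* k ∸ k ≡ k
  2k∸k≡k = trans (NP.m+n∸m≡n k (k ℕ.+ 0)) (NP.+-identityʳ k)
  negate : ∀ t s o → - s * o * o ≡ t * 0ℚ - s * o * o
  negate = solve-∀ ℚ-ring
... | tri> _ _ j<2k = begin
  chebU (suc (suc j)) (suc k)        ≡⟨ chebU-vanish (suc (suc j)) (suc k) (subst (suc (suc j) <_) (sym (NP.*-suc 2 k)) (s≤s (s≤s j<2k))) ⟩
  0ℚ                                 ≡⟨ t*0-0≡0 (ι 2) ⟨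
  ι 2 * 0ℚ - 0ℚ                      ≡⟨ cong₂ (λ a b → ι 2 * a - b)
                                              (sym (chebU-vanish (suc j) (suc k) (subst (suc j <_) (sym (NP.*-suc 2 k)) (s≤s (NP.m<n⇒m<1+n j<2k)))))
                                              (sym (chebU-vanish j k j<2k)) ⟩
  ι 2 * chebU (suc j) (suc k) - chebU j k ∎
  where
  open ≡-Reasoning
  t*0-0≡0 : ∀ t → t * 0ℚ - 0ℚ ≡ 0ℚ
  t*0-0≡0 = solve-∀ ℚ-ring

chebU-0 : ∀ j → chebU j 0 ≡ ι (2 ℕ.^ j)
chebU-0 j = trans (cong (1ℚ * ι (2 ℕ.^ j) *_) ι-1) (trans (QP.*-identityʳ _) (QP.*-identityˡ _))

∑chebU-rec : ∀ j → ∑ (3 ℕ.+ j) (chebU (2 ℕ.+ j)) ≡ ι 2 * ∑ (2 ℕ.+ j) (chebU (1 ℕ.+ j)) - ∑ (1 ℕ.+ j) (chebU j)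
∑chebU-rec j = begin
  chebU (2 ℕ.+ j) 0 + ∑ (2 ℕ.+ j) (λ k → chebU (2 ℕ.+ j) (suc k))
      ≡⟨ cong₂ _+_ (trans (chebU-0 (2 ℕ.+ j)) (ι-2^suc (suc j))) (∑-cong (2 ℕ.+ j) (λ k _ → chebU-rec j k)) ⟩
  ι 2 * ι (2 ℕ.^ suc j) + ∑ (2 ℕ.+ j) (λ k → ι 2 * chebU (1 ℕ.+ j) (suc k) - chebU j k)
      ≡⟨ cong (ι 2 * ι (2 ℕ.^ suc j) +_) (trans (∑-minus (2 ℕ.+ j) (λ k → ι 2 * chebU (1 ℕ.+ j) (suc k)) (chebU j))
                                                 (cong (_- ∑ (2 ℕ.+ j) (chebU j)) (sym (∑-*ˡ (2 ℕ.+ j) (ι 2) (λ k → chebU (1 ℕ.+ j) (suc k)))))) ⟩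
  ι 2 * ι (2 ℕ.^ suc j) + (ι 2 * ∑ (2 ℕ.+ j) (λ k → chebU (1 ℕ.+ j) (suc k)) - ∑ (2 ℕ.+ j) (chebU j))
      ≡⟨ cong₂ (λ a b → ι 2 * ι (2 ℕ.^ suc j) + (ι 2 * a - b)) 
               (∑-drop-last (suc j) (λ k → chebU (1 ℕ.+ j) (suc k)) (chebU-vanish (suc j) (suc (suc j)) (n<2[1+n] (suc j))))
               (∑-drop-last (suc j) (chebU j) (chebU-vanish j (suc j) (n<2[1+n] j))) ⟩
  ι 2 * ι (2 ℕ.^ suc j) + (ι 2 * ∑ (1 ℕ.+ j) (λ k → chebU (1 ℕ.+ j) (suc k)) - ∑ (1 ℕ.+ j) (chebU j))
      ≡⟨ regroup (ι 2) (ι (2 ℕ.^ suc j)) (∑ (1 ℕ.+ j) (λ k → chebU (1 ℕ.+ j) (suc k))) (∑ (1 ℕ.+ j) (chebU j)) ⟩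
  ι 2 * (ι (2 ℕ.^ suc j) + ∑ (1 ℕ.+ j) (λ k → chebU (1 ℕ.+ j) (suc k))) - ∑ (1 ℕ.+ j) (chebU j)
      ≡⟨ cong (λ x → ι 2 * (x + ∑ (1 ℕ.+ j) (λ k → chebU (1 ℕ.+ j) (suc k))) - ∑ (1 ℕ.+ j) (chebU j)) (chebU-0 (suc j)) ⟨
  ι 2 * ∑ (2 ℕ.+ j) (chebU (1 ℕ.+ j)) - ∑ (1 ℕ.+ j) (chebU j) ∎
  where
  open ≡-Reasoning
  n<2[1+n] : ∀ n → n < 2 ℕ.* suc n
  n<2[1+n] n = NP.≤-trans (NP.n≤1+n (suc n)) (subst (suc (suc n) ≤_) (sym (NP.*-suc 2 n)) (s≤s (s≤s (NP.m≤m+n n (n ℕ.+ 0)))))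
  regroup : ∀ t p y v → t * p + (t * y - v) ≡ t * (p + y) - v
  regroup = solve-∀ ℚ-ring

∑chebU : ∀ j → ∑ (suc j) (chebU j) ≡ ι (suc j)
∑chebU zero = trans (QP.+-identityʳ _) (chebU-0 0)
∑chebU (suc zero) = begin
  chebU 1 0 + (chebU 1 1 + 0ℚ)    ≡⟨ cong₂ (λ a b → a + (b + 0ℚ)) (chebU-0 1) (chebU-vanish 1 1 (s≤s (s≤s z≤n))) ⟩
  ι 2 + (0ℚ + 0ℚ)                 ≡⟨ QP.+-identityʳ (ι 2) ⟩
  ι 2                             ∎
  where open ≡-Reasoning
∑chebU (suc (suc j)) = begin
  ∑ (3 ℕ.+ j) (chebU (2 ℕ.+ j))                       ≡⟨ ∑chebU-rec j ⟩
  ι 2 * ∑ (2 ℕ.+ j) (chebU (1 ℕ.+ j)) - ∑ (1 ℕ.+ j) (chebU j) ≡⟨ cong₂ (λ a b → ι 2 * a - b) (∑chebU (suc j)) (∑chebU j) ⟩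
  ι 2 * ι (2 ℕ.+ j) - ι (1 ℕ.+ j)                     ≡⟨ cong₂ (λ a b → ι 2 * a - b) (ι-+ 2 j) (ι-+ 1 j) ⟩
  ι 2 * (ι 2 + ι j) - (ι 1 + ι j)                     ≡⟨ cong₂ (λ t o → t * (t + ι j) - (o + ι j)) ι-2 ι-1 ⟩
  (1ℚ + 1ℚ) * ((1ℚ + 1ℚ) + ι j) - (1ℚ + ι j)          ≡⟨ arithmetic (ι j) ⟩
  (1ℚ + 1ℚ) + (1ℚ + ι j)                              ≡⟨ cong₂ (λ t o → t + (o + ι j)) ι-2 ι-1 ⟨
  ι 2 + (ι 1 + ι j)                                   ≡⟨ trans (ι-+ 2 (suc j)) (cong (ι 2 +_) (ι-+ 1 j)) ⟨
  ι (3 ℕ.+ j)                                         ∎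
  where
  open ≡-Reasoning
  arithmetic : ∀ x → (1ℚ + 1ℚ) * ((1ℚ + 1ℚ) + x) - (1ℚ + x) ≡ (1ℚ + 1ℚ) + (1ℚ + x)
  arithmetic = solve-∀ ℚ-ring

-- The coefficient in T j = (U j - U (j - 2)) / 2, at x = 1.  For j < 2 the
-- truncated j ∸ 2 makes this wrong beyond the first coefficient.
chebT : ℕ → ℕ → ℚ
chebT j zero    = ι (2 ℕ.^ j) ÷' ι 2
chebT j (suc a) = (chebU j (suc a) - chebU (j ∸ 2) a) ÷' ι 2

chebT-vanish : ∀ j k → 2 ℕ.+ j < 2 ℕ.* k → chebT (2 ℕ.+ j) k ≡ 0ℚ
chebT-vanish j (suc a) j+2<2+2a = begin
  (chebU (2 ℕ.+ j) (suc a) - chebU j a) ÷' ι 2       ≡⟨ cong₂ (λ x y → (x - y) ÷' ι 2) (chebU-vanish (2 ℕ.+ j) (suc a) j+2<2+2a)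
                                                                 (chebU-vanish j a (NP.≤-pred (NP.≤-pred (subst (3 ℕ.+ j ≤_) (NP.*-suc 2 a) j+2<2+2a)))) ⟩
  (0ℚ - 0ℚ) ÷' ι 2                                    ≡⟨ ÷2≡*½ (0ℚ - 0ℚ) ⟩
  (0ℚ - 0ℚ) * ½                                       ≡⟨ QP.*-zeroˡ ½ ⟩
  0ℚ                                                  ∎
  where open ≡-Reasoning

∑chebT : ∀ j → ∑ (3 ℕ.+ j) (chebT (2 ℕ.+ j)) ≡ 1ℚ
∑chebT j = begin
  chebT (2 ℕ.+ j) 0 + ∑ (2 ℕ.+ j) (λ a → (chebU (2 ℕ.+ j) (suc a) - chebU j a) ÷' ι 2)
      ≡⟨ cong₂ _+_ (÷2≡*½ (ι (2 ℕ.^ (2 ℕ.+ j)))) (∑-cong (2 ℕ.+ j) (λ a _ → ÷2≡*½ (chebU (2 ℕ.+ j) (suc a) - chebU j a))) ⟩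
  ι (2 ℕ.^ (2 ℕ.+ j)) * ½ + ∑ (2 ℕ.+ j) (λ a → (chebU (2 ℕ.+ j) (suc a) - chebU j a) * ½)
      ≡⟨ cong₂ (λ x y → x * ½ + y) (sym (chebU-0 (2 ℕ.+ j)))
               (trans (sym (∑-*ʳ (2 ℕ.+ j) ½ (λ a → chebU (2 ℕ.+ j) (suc a) - chebU j a)))
                      (cong (_* ½) (∑-minus (2 ℕ.+ j) (λ a → chebU (2 ℕ.+ j) (suc a)) (chebU j)))) ⟩
  chebU (2 ℕ.+ j) 0 * ½ + (∑ (2 ℕ.+ j) (λ a → chebU (2 ℕ.+ j) (suc a)) - ∑ (2 ℕ.+ j) (chebU j)) * ½
      ≡⟨ factor (chebU (2 ℕ.+ j) 0) (∑ (2 ℕ.+ j) (λ a → chebU (2 ℕ.+ j) (suc a))) (∑ (2 ℕ.+ j) (chebU j)) ½ ⟩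
  (∑ (3 ℕ.+ j) (chebU (2 ℕ.+ j)) - ∑ (2 ℕ.+ j) (chebU j)) * ½
      ≡⟨ cong (λ x → (∑ (3 ℕ.+ j) (chebU (2 ℕ.+ j)) - x) * ½)
              (∑-drop-last (suc j) (chebU j) (chebU-vanish j (suc j) (NP.m≤m+n (suc j) (suc j ℕ.+ 0)))) ⟩
  (∑ (3 ℕ.+ j) (chebU (2 ℕ.+ j)) - ∑ (1 ℕ.+ j) (chebU j)) * ½
      ≡⟨ cong₂ (λ x y → (x - y) * ½) (∑chebU (2 ℕ.+ j)) (∑chebU j) ⟩
  (ι (2 ℕ.+ suc j) - ι (suc j)) * ½
      ≡⟨ cong (λ x → (x - ι (suc j)) * ½) (ι-+ 2 (suc j)) ⟩
  (ι 2 + ι (suc j) - ι (suc j)) * ½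
      ≡⟨ cancel (ι 2) (ι (suc j)) ½ ⟩
  ι 2 * ½
      ≡⟨ ÷2≡*½ (ι 2) ⟨
  ι 2 ÷' ι 2
      ≡⟨ ÷'-self (ι-suc≢0 1) ⟩
  1ℚ ∎
  where
  open ≡-Reasoning
  factor : ∀ u s t h → u * h + (s - t) * h ≡ (u + s - t) * h
  factor = solve-∀ ℚ-ring
  cancel : ∀ a b h → (a + b - b) * h ≡ a * h
  cancel = solve-∀ ℚ-ring

∑chebU-half : ∀ j → ∑ (suc (j ℕ./ 2)) (chebU j) ≡ ι (suc j)
∑chebU-half j = trans (∑-up-to-half j (chebU j) (chebU-vanish j)) (∑chebU j)

∑chebT-half : ∀ j → 1 ≤ j → ∑ (suc (j ℕ./ 2)) (chebT j) ≡ 1ℚ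
∑chebT-half (suc zero)    _ = trans (QP.+-identityʳ _) (÷'-self (ι-suc≢0 1))
∑chebT-half (suc (suc j)) _ = trans (∑-up-to-half (2 ℕ.+ j) (chebT (2 ℕ.+ j)) (chebT-vanish j)) (∑chebT j)

ballot-closed : ∀ r a → ballot (r ℕ.+ 2 ℕ.* a) a * ι (a !) * ι (suc (r ℕ.+ a) !) ≡ sgn a * ι ((r ℕ.+ 2 ℕ.* a) !) * ι (suc r)
ballot-closed r zero = begin
  ballot (r ℕ.+ 0) 0 * ι 1 * ι (suc (r ℕ.+ 0) !)    ≡⟨ cong₂ (λ b i → b * ι 1 * ι (suc i !)) (ballot-0 (r ℕ.+ 0)) (NP.+-identityʳ r) ⟩
  1ℚ * ι 1 * ι (suc r !)                            ≡⟨ cong₂ (λ o f → 1ℚ * o * f) ι-1 (ι-suc-! r) ⟩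
  1ℚ * 1ℚ * (ι (suc r) * ι (r !))                   ≡⟨ rearrange (ι (suc r)) (ι (r !)) ⟩
  1ℚ * ι (r !) * ι (suc r)                          ≡⟨ cong (λ i → 1ℚ * ι (i !) * ι (suc r)) (sym (NP.+-identityʳ r)) ⟩
  sgn 0 * ι ((r ℕ.+ 0) !) * ι (suc r)               ∎
  where
  open ≡-Reasoning
  rearrange : ∀ x y → 1ℚ * 1ℚ * (x * y) ≡ 1ℚ * y * x
  rearrange = solve-∀ ℚ-ring
ballot-closed r (suc a) = begin
  s * (C₁ - C₀) * ι (suc a !) * ι (suc (r ℕ.+ suc a) !)
      ≡⟨ cong₂ (λ x y → s * (C₁ - C₀) * x * y) (ι-suc-! a) (ι-suc-! (r ℕ.+ suc a)) ⟩
  s * (C₁ - C₀) * (ι (suc a) * ι (a !)) * (ι (suc (r ℕ.+ suc a)) * ι ((r ℕ.+ suc a) !))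
      ≡⟨ distribute s C₁ C₀ (ι (suc a)) (ι (a !)) (ι (suc (r ℕ.+ suc a))) (ι ((r ℕ.+ suc a) !)) ⟩
  s * (C₁ * (ι (suc a) * ι (a !)) * ι ((r ℕ.+ suc a) !) * ι (suc (r ℕ.+ suc a))
       - C₀ * ι (a !) * (ι (suc (r ℕ.+ suc a)) * ι ((r ℕ.+ suc a) !)) * ι (suc a))
      ≡⟨ cong₂ (λ x y → s * (x * ι (suc (r ℕ.+ suc a)) - y * ι (suc a))) C₁-factorial C₀-factorial ⟩
  s * (ι (n !) * ι (suc (r ℕ.+ suc a)) - ι (n !) * ι (suc a))
      ≡⟨ cong (λ x → s * (ι (n !) * x - ι (n !) * ι (suc a))) (ι-+ (suc r) (suc a)) ⟩
  s * (ι (n !) * (ι (suc r) + ι (suc a)) - ι (n !) * ι (suc a))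
      ≡⟨ cancel s (ι (n !)) (ι (suc r)) (ι (suc a)) ⟩
  s * ι (n !) * ι (suc r) ∎
  where
  open ≡-Reasoning
  n = r ℕ.+ 2 ℕ.* suc a
  s = sgn (suc a)
  C₁ = ι (n C suc a)
  C₀ = ι (n C a)
  distribute : ∀ s c₁ c₀ x y z w → s * (c₁ - c₀) * (x * y) * (z * w) ≡ s * (c₁ * (x * y) * w * z - c₀ * y * (z * w) * x)
  distribute = solve-∀ ℚ-ring
  cancel : ∀ s f x y → s * (f * (x + y) - f * y) ≡ s * f * x
  cancel = solve-∀ ℚ-ring
  n≡₁ : ∀ r a → suc a ℕ.+ (r ℕ.+ suc a) ≡ r ℕ.+ 2 ℕ.* suc a
  n≡₁ = ℕ-Solver.solve-∀
  n≡₀ : ∀ r a → a ℕ.+ (r ℕ.+ suc (suc a)) ≡ r ℕ.+ 2 ℕ.* suc a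
  n≡₀ = ℕ-Solver.solve-∀
  C₁-factorial : C₁ * (ι (suc a) * ι (a !)) * ι ((r ℕ.+ suc a) !) ≡ ι (n !)
  C₁-factorial = trans (cong (λ x → C₁ * x * ι ((r ℕ.+ suc a) !)) (sym (ι-suc-! a)))
    (subst (λ i → ι (i C suc a) * ι (suc a !) * ι ((r ℕ.+ suc a) !) ≡ ι (i !)) (n≡₁ r a) (C-factorial (suc a) (r ℕ.+ suc a)))
  C₀-factorial : C₀ * ι (a !) * (ι (suc (r ℕ.+ suc a)) * ι ((r ℕ.+ suc a) !)) ≡ ι (n !)
  C₀-factorial = trans (cong (C₀ * ι (a !) *_) (trans (sym (ι-suc-! (r ℕ.+ suc a))) (cong (λ i → ι (i !)) (sym (NP.+-suc r (suc a))))))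
    (subst (λ i → ι (i C a) * ι (a !) * ι ((r ℕ.+ suc (suc a)) !) ≡ ι (i !)) (n≡₀ r a) (C-factorial a (r ℕ.+ suc (suc a))))

chebT-closed : ∀ n a → chebT (n ℕ.+ 2 ℕ.* a) a * ι 2 * ι (a !) * ι (n !) * ι (n ℕ.+ a)
                     ≡ sgn a * ι (n ℕ.+ 2 ℕ.* a) * ι (2 ℕ.^ n) * ι ((n ℕ.+ a) !)
chebT-closed n zero = begin
  (ι (2 ℕ.^ (n ℕ.+ 0)) ÷' ι 2) * ι 2 * ι 1 * ι (n !) * ι (n ℕ.+ 0)
      ≡⟨ cong₂ (λ x o → x * o * ι (n !) * ι (n ℕ.+ 0)) (÷'-*-cancel (ι (2 ℕ.^ (n ℕ.+ 0))) (ι 2) (ι-suc≢0 1)) ι-1 ⟩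
  ι (2 ℕ.^ (n ℕ.+ 0)) * 1ℚ * ι (n !) * ι (n ℕ.+ 0)
      ≡⟨ rearrange (ι (2 ℕ.^ (n ℕ.+ 0))) (ι (n !)) (ι (n ℕ.+ 0)) ⟩
  1ℚ * ι (n ℕ.+ 0) * ι (2 ℕ.^ (n ℕ.+ 0)) * ι (n !)
      ≡⟨ cong (λ i → 1ℚ * ι (n ℕ.+ 0) * ι (2 ℕ.^ i) * ι (n !)) (NP.+-identityʳ n) ⟩
  1ℚ * ι (n ℕ.+ 0) * ι (2 ℕ.^ n) * ι (n !)
      ≡⟨ cong (λ i → 1ℚ * ι (n ℕ.+ 0) * ι (2 ℕ.^ n) * ι (i !)) (sym (NP.+-identityʳ n)) ⟩
  sgn 0 * ι (n ℕ.+ 0) * ι (2 ℕ.^ n) * ι ((n ℕ.+ 0) !) ∎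
  where
  open ≡-Reasoning
  rearrange : ∀ p f q → p * 1ℚ * f * q ≡ 1ℚ * q * p * f
  rearrange = solve-∀ ℚ-ring
chebT-closed n (suc a) = begin
  chebT j (suc a) * ι 2 * ι (suc a !) * ι (n !) * ι (n ℕ.+ suc a)
      ≡⟨ cong₂ (λ x i → x * ι (suc a !) * ι (n !) * ι i) (÷'-*-cancel (chebU j (suc a) - chebU (j ∸ 2) a) (ι 2) (ι-suc≢0 1)) N≡ ⟩
  (chebU j (suc a) - chebU (j ∸ 2) a) * ι (suc a !) * ι (n !) * N
      ≡⟨ cong₃ (λ x y z → (x - y) * z * ι (n !) * N) chebU₁ chebU₀ (ι-suc-! a) ⟩
  (s₁ * P * C₁ - s₀ * P * C₀) * (ι (suc a) * ι (a !)) * ι (n !) * N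
      ≡⟨ distribute s₁ s₀ P C₁ C₀ (ι (suc a)) (ι (a !)) (ι (n !)) N ⟩
  s₁ * P * (C₁ * (ι (suc a) * ι (a !)) * ι (n !)) * N - s₀ * P * (C₀ * ι (a !) * ι (n !)) * ι (suc a) * N
      ≡⟨ cong₂ (λ x y → s₁ * P * x * N - s₀ * P * y * ι (suc a) * N) C₁-factorial (C-factorial a n) ⟩
  s₁ * P * ι (suc (a ℕ.+ n) !) * N - s₀ * P * ι ((a ℕ.+ n) !) * ι (suc a) * N
      ≡⟨ cong₂ (λ x s → s₁ * P * x * N - s * P * ι ((a ℕ.+ n) !) * ι (suc a) * N) (ι-suc-! (a ℕ.+ n)) s₀≡-s₁ ⟩
  s₁ * P * (N * ι ((a ℕ.+ n) !)) * N - (- s₁) * P * ι ((a ℕ.+ n) !) * ι (suc a) * N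
      ≡⟨ collect s₁ P N (ι ((a ℕ.+ n) !)) (ι (suc a)) ⟩
  s₁ * (N + ι (suc a)) * P * (N * ι ((a ℕ.+ n) !))
      ≡⟨ cong₂ (λ x y → s₁ * x * P * y) (trans (sym (ι-+ (suc (a ℕ.+ n)) (suc a))) (cong ι j≡)) (sym (ι-suc-! (a ℕ.+ n))) ⟩
  s₁ * ι j * P * ι (suc (a ℕ.+ n) !)
      ≡⟨ cong (λ i → s₁ * ι j * P * ι (i !)) (sym N≡) ⟩
  sgn (suc a) * ι j * ι (2 ℕ.^ n) * ι ((n ℕ.+ suc a) !) ∎
  where
  open ≡-Reasoning
  j = n ℕ.+ 2 ℕ.* suc a
  s₁ = sgn (suc a)
  s₀ = sgn a
  P = ι (2 ℕ.^ n)
  N = ι (suc (a ℕ.+ n))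
  C₁ = ι ((suc a ℕ.+ n) C suc a)
  C₀ = ι ((a ℕ.+ n) C a)
  cong₃ : ∀ (f : ℚ → ℚ → ℚ → ℚ) {x x′ y y′ z z′} → x ≡ x′ → y ≡ y′ → z ≡ z′ → f x y z ≡ f x′ y′ z′
  cong₃ f refl refl refl = refl
  N≡ : n ℕ.+ suc a ≡ suc (a ℕ.+ n)
  N≡ = trans (NP.+-suc n a) (cong suc (NP.+-comm n a))
  j≡ : suc (a ℕ.+ n) ℕ.+ suc a ≡ j
  j≡ = j≡′ n a
    where
    j≡′ : ∀ n a → suc (a ℕ.+ n) ℕ.+ suc a ≡ n ℕ.+ 2 ℕ.* suc a
    j≡′ = ℕ-Solver.solve-∀
  j∸2≡ : j ∸ 2 ≡ n ℕ.+ 2 ℕ.* a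
  j∸2≡ = trans (cong (_∸ 2) (j≡′ n a)) (NP.m+n∸n≡m _ 2)
    where
    j≡′ : ∀ n a → n ℕ.+ 2 ℕ.* suc a ≡ (n ℕ.+ 2 ℕ.* a) ℕ.+ 2
    j≡′ = ℕ-Solver.solve-∀
  chebU₁ : chebU j (suc a) ≡ s₁ * P * C₁
  chebU₁ = cong₂ (λ x y → s₁ * ι (2 ℕ.^ x) * ι (y C suc a))
                 (NP.m+n∸n≡m n (2 ℕ.* suc a))
                 (trans (cong (_∸ suc a) (j≡′ n a)) (NP.m+n∸n≡m (suc a ℕ.+ n) (suc a)))
    where
    j≡′ : ∀ n a → n ℕ.+ 2 ℕ.* suc a ≡ (suc a ℕ.+ n) ℕ.+ suc a
    j≡′ = ℕ-Solver.solve-∀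
  chebU₀ : chebU (j ∸ 2) a ≡ s₀ * P * C₀
  chebU₀ = cong₂ (λ x y → s₀ * ι (2 ℕ.^ x) * ι (y C a))
                 (trans (cong (_∸ 2 ℕ.* a) j∸2≡) (NP.m+n∸n≡m n (2 ℕ.* a)))
                 (trans (cong (_∸ a) (trans j∸2≡ (n+2a≡ n a))) (NP.m+n∸n≡m (a ℕ.+ n) a))
    where
    n+2a≡ : ∀ n a → n ℕ.+ 2 ℕ.* a ≡ (a ℕ.+ n) ℕ.+ a
    n+2a≡ = ℕ-Solver.solve-∀
  C₁-factorial : C₁ * (ι (suc a) * ι (a !)) * ι (n !) ≡ ι (suc (a ℕ.+ n) !)
  C₁-factorial = trans (cong (λ x → C₁ * x * ι (n !)) (sym (ι-suc-! a))) (C-factorial (suc a) n)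
  s₀≡-s₁ : s₀ ≡ - s₁
  s₀≡-s₁ = sym (trans (cong -_ (sgn-suc a)) (neg-involutive (sgn a)))
    where
    neg-involutive : ∀ x → - - x ≡ x
    neg-involutive = solve-∀ ℚ-ring
  distribute : ∀ s₁ s₀ p c₁ c₀ x f g m →
    (s₁ * p * c₁ - s₀ * p * c₀) * (x * f) * g * m ≡ s₁ * p * (c₁ * (x * f) * g) * m - s₀ * p * (c₀ * f * g) * x * m
  distribute = solve-∀ ℚ-ring
  collect : ∀ s p m f x → s * p * (m * f) * m - (- s) * p * f * x * m ≡ s * (m + x) * p * (m * f)
  collect = solve-∀ ℚ-ring

hypTerm : ℕ → ℚ → ℚ → ℚ → ℕ → ℚ
hypTerm m b c z k = (poch (- ι m) k * poch b k) ÷' (poch c k * ι (k !)) * z ^ℚ k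

coef-i : ℕ → ℕ → ℚ
coef-i j m = sgn m * ι ((j ∸ m) C (j ∸ 2 ℕ.* m)) * (ι (2 ℕ.^ (j ∸ 2 ℕ.* m)) ÷' ι 2 ÷' ι (j ∸ m))

coef-ii : ℕ → ℕ → ℚ
coef-ii j m = sgn (suc m) * ι (j C m) * ((- ι j + ι (2 ℕ.* m) - 1ℚ) ÷' (ι j - ι m + 1ℚ))

neg-quarter : ℚ
neg-quarter = - (1ℚ ÷' ι 4)

hypTerm-i : ℕ → ℕ → ℕ → ℚ
hypTerm-i j m = hypTerm m (ι (j ∸ m)) (ι (j ∸ 2 ℕ.* m) + ι 2) (- ι 4)

hypTerm-ii : ℕ → ℕ → ℕ → ℚ
hypTerm-ii j m = hypTerm m (- ι j + ι m - 1ℚ) (- ι j) neg-quarter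

neg-quarter^k*4^k : ∀ k → neg-quarter ^ℚ k * ι (4 ℕ.^ k) ≡ sgn k
neg-quarter^k*4^k zero = cong (1ℚ *_) ι-1
neg-quarter^k*4^k (suc k) = begin
  neg-quarter * neg-quarter ^ℚ k * ι (4 ℕ.* 4 ℕ.^ k)        ≡⟨ cong (neg-quarter * neg-quarter ^ℚ k *_) (ι-* 4 (4 ℕ.^ k)) ⟩
  neg-quarter * neg-quarter ^ℚ k * (ι 4 * ι (4 ℕ.^ k))     ≡⟨ interchange neg-quarter (neg-quarter ^ℚ k) (ι 4) (ι (4 ℕ.^ k)) ⟩
  (neg-quarter * ι 4) * (neg-quarter ^ℚ k * ι (4 ℕ.^ k))   ≡⟨ cong₂ _*_ neg-quarter*4≡-1 (neg-quarter^k*4^k k) ⟩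
  (- 1ℚ) * sgn k                                           ∎
  where
  open ≡-Reasoning
  interchange : ∀ a b c e → a * b * (c * e) ≡ (a * c) * (b * e)
  interchange = solve-∀ ℚ-ring
  neg-* : ∀ x y → (- x) * y ≡ - (x * y)
  neg-* = solve-∀ ℚ-ring
  neg-quarter*4≡-1 : neg-quarter * ι 4 ≡ - 1ℚ
  neg-quarter*4≡-1 = trans (neg-* (1ℚ ÷' ι 4) (ι 4)) (cong -_ (÷'-*-cancel 1ℚ (ι 4) (ι-suc≢0 3)))

2^[x+2k] : ∀ x k → ι (2 ℕ.^ (x ℕ.+ 2 ℕ.* k)) ≡ ι (2 ℕ.^ x) * ι (4 ℕ.^ k)
2^[x+2k] x k = trans (cong ι (trans (NP.^-distribˡ-+-* 2 x (2 ℕ.* k)) (cong (2 ℕ.^ x ℕ.*_) (sym (NP.^-*-assoc 2 2 k)))))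
              (ι-* (2 ℕ.^ x) (4 ℕ.^ k))

[-4]^k : ∀ k → (- ι 4) ^ℚ k ≡ sgn k * ι (4 ℕ.^ k)
[-4]^k zero = trans (sym (QP.*-identityʳ 1ℚ)) (cong (1ℚ *_) (sym ι-1))
[-4]^k (suc k) = begin
    (- ι 4) * (- ι 4) ^ℚ k                ≡⟨ cong ((- ι 4) *_) ([-4]^k k) ⟩
    (- ι 4) * (sgn k * ι (4 ℕ.^ k))        ≡⟨ pull-sign (ι 4) (sgn k) (ι (4 ℕ.^ k)) ⟩
    ((- 1ℚ) * sgn k) * (ι 4 * ι (4 ℕ.^ k)) ≡⟨ cong (((- 1ℚ) * sgn k) *_) (sym (ι-* 4 (4 ℕ.^ k))) ⟩
    ((- 1ℚ) * sgn k) * ι (4 ℕ.^ suc k) ∎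
  where
  open ≡-Reasoning
  pull-sign : ∀ f s p → (- f) * (s * p) ≡ ((- 1ℚ) * s) * (f * p)
  pull-sign = solve-∀ ℚ-ring

-- Once every Pochhammer symbol, binomial coefficient and power is traded for
-- factorials, a term identity becomes an identity of monomials after
-- multiplying by the (nonzero) product D of all denominators.
term-ii-cleared : ∀ (2^n 4^k σa σk ε Cjm ratio hyp zᵏ Pa Pb Pc Ckn bal a! [1+r+a]! [j-k]! k! R! m! j! n! 1+R 1+r : ℚ) →
  Cjm * m! * R! ≡ j! →
  ratio * 1+R ≡ ε * 1+r →
  Pa * a! ≡ σk * m! →
  Pb * [1+r+a]! ≡ σk * (1+R * R!) →
  Pc * [j-k]! ≡ σk * j! →
  hyp * (Pc * k!) ≡ Pa * Pb →
  zᵏ * 4^k ≡ σk →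
  Ckn * k! * n! ≡ [j-k]! →
  bal * a! * [1+r+a]! ≡ σa * n! * 1+r →
  σk * σk ≡ 1ℚ →
  ε * ε ≡ 1ℚ →
  m! * R! * 1+R * (Pc * k!) * 4^k * a! * [1+r+a]! * n! * [j-k]! ≢ 0ℚ →
  (2^n * 4^k) * ((ε * (σa * σk) * Cjm * ratio) * (hyp * zᵏ)) ≡ (σk * 2^n * Ckn) * bal
term-ii-cleared 2^n 4^k σa σk ε Cjm ratio hyp zᵏ Pa Pb Pc Ckn bal a! [1+r+a]! [j-k]! k! R! m! j! n! 1+R 1+r binomial-jm ratio-cleared poch-a poch-b poch-c hyp-cleared zᵏ-cleared binomial-kn ballot-cleared σk²≡1 ε²≡1 D≢0 =
  *-cancelʳ D D≢0 (trans lhs*D (sym rhs*D))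
  where
  open ≡-Reasoning
  D = m! * R! * 1+R * (Pc * k!) * 4^k * a! * [1+r+a]! * n! * [j-k]!
  common = σa * 2^n * 4^k * j! * 1+r * m! * 1+R * R! * n! * [j-k]!
  rest₁ = 2^n * 4^k * ε * σa * σk * a! * [1+r+a]! * n! * [j-k]!
  rest₂ = j! * ε * 1+r * σk * 2^n * 4^k * ε * σa * σk * n! * [j-k]!
  lhs*D : (2^n * 4^k) * ((ε * (σa * σk) * Cjm * ratio) * (hyp * zᵏ)) * D ≡ common
  lhs*D = begin
    (2^n * 4^k) * ((ε * (σa * σk) * Cjm * ratio) * (hyp * zᵏ)) * D
      ≡⟨ msolve 18 (λ 2^n 4^k ε σa σk Cjm ratio hyp zᵏ m! R! 1+R Pc k! a! [1+r+a]! n! [j-k]! → (((2^n ⊕m 4^k) ⊕m ((((ε ⊕m (σa ⊕m σk)) ⊕m Cjm) ⊕m ratio) ⊕m (hyp ⊕m zᵏ))) ⊕m ((((((((m! ⊕m R!) ⊕m 1+R) ⊕m (Pc ⊕m k!)) ⊕m 4^k) ⊕m a!) ⊕m [1+r+a]!) ⊕m n!) ⊕m [j-k]!)) ⊜m ((((((Cjm ⊕m m!) ⊕m R!) ⊕m (ratio ⊕m 1+R)) ⊕m (hyp ⊕m (Pc ⊕m k!))) ⊕m (zᵏ ⊕m 4^k)) ⊕m ((((((((2^n ⊕m 4^k) ⊕m ε) ⊕m σa) ⊕m σk) ⊕m a!) ⊕m [1+r+a]!) ⊕m n!) ⊕m [j-k]!))) refl 2^n 4^k ε σa σk Cjm ratio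 hyp zᵏ m! R! 1+R Pc k! a! [1+r+a]! n! [j-k]! ⟩
    (Cjm * m! * R!) * (ratio * 1+R) * (hyp * (Pc * k!)) * (zᵏ * 4^k) * rest₁
      ≡⟨ cong₂ (λ p q → p * q * rest₁) (cong₂ _*_ (cong₂ _*_ binomial-jm ratio-cleared) hyp-cleared) zᵏ-cleared ⟩
    j! * (ε * 1+r) * (Pa * Pb) * σk * rest₁
      ≡⟨ msolve 13 (λ j! ε 1+r Pa Pb σk 2^n 4^k σa a! [1+r+a]! n! [j-k]! → ((((j! ⊕m (ε ⊕m 1+r)) ⊕m (Pa ⊕m Pb)) ⊕m σk) ⊕m ((((((((2^n ⊕m 4^k) ⊕m ε) ⊕m σa) ⊕m σk) ⊕m a!) ⊕m [1+r+a]!) ⊕m n!) ⊕m [j-k]!)) ⊜m (((Pa ⊕m a!) ⊕m (Pb ⊕m [1+r+a]!)) ⊕m ((((((((((j! ⊕m ε) ⊕m 1+r) ⊕m σk) ⊕m 2^n) ⊕m 4^k) ⊕m ε) ⊕m σa) ⊕m σk) ⊕m n!) ⊕m [j-k]!))) refl j! ε 1+r Pa Pb σk 2^n 4^k σa a! [1+r+a]! n! [j-k]! ⟩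
    (Pa * a!) * (Pb * [1+r+a]!) * rest₂
      ≡⟨ cong₂ (λ p q → p * q * rest₂) poch-a poch-b ⟩
    (σk * m!) * (σk * (1+R * R!)) * rest₂
      ≡⟨ msolve 12 (λ σk m! 1+R R! j! ε 1+r 2^n 4^k σa n! [j-k]! → (((σk ⊕m m!) ⊕m (σk ⊕m (1+R ⊕m R!))) ⊕m ((((((((((j! ⊕m ε) ⊕m 1+r) ⊕m σk) ⊕m 2^n) ⊕m 4^k) ⊕m ε) ⊕m σa) ⊕m σk) ⊕m n!) ⊕m [j-k]!)) ⊜m ((ε ⊕m ε) ⊕m ((σk ⊕m σk) ⊕m ((σk ⊕m σk) ⊕m (((((((((σa ⊕m 2^n) ⊕m 4^k) ⊕m j!) ⊕m 1+r) ⊕m m!) ⊕m 1+R) ⊕m R!) ⊕m n!) ⊕m [j-k]!))))) refl σk m! 1+R R! j! ε 1+r 2^n 4^k σa n! [j-k]! ⟩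
    (ε * ε) * ((σk * σk) * ((σk * σk) * common))
      ≡⟨ cong₂ (λ p q → p * (q * (q * common))) ε²≡1 σk²≡1 ⟩
    1ℚ * (1ℚ * (1ℚ * common))
      ≡⟨ trans (QP.*-identityˡ _) (trans (QP.*-identityˡ _) (QP.*-identityˡ common)) ⟩
    common ∎
  rhs*D : (σk * 2^n * Ckn) * bal * D ≡ common
  rhs*D = begin
    (σk * 2^n * Ckn) * bal * D
      ≡⟨ msolve 14 (λ σk 2^n Ckn bal m! R! 1+R Pc k! 4^k a! [1+r+a]! n! [j-k]! → ((((σk ⊕m 2^n) ⊕m Ckn) ⊕m bal) ⊕m ((((((((m! ⊕m R!) ⊕m 1+R) ⊕m (Pc ⊕m k!)) ⊕m 4^k) ⊕m a!) ⊕m [1+r+a]!) ⊕m n!) ⊕m [j-k]!)) ⊜m (((((Ckn ⊕m k!) ⊕m n!) ⊕m ((bal ⊕m a!) ⊕m [1+r+a]!)) ⊕m (Pc ⊕m [j-k]!)) ⊕m (((((σk ⊕m 2^n) ⊕m m!) ⊕m R!) ⊕m 1+R) ⊕m 4^k))) refl σk 2^n Ckn bal m! R! 1+R Pc k! 4^k a! [1+r+a]! n! [j-k]! ⟩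
    (Ckn * k! * n!) * (bal * a! * [1+r+a]!) * (Pc * [j-k]!) * (σk * 2^n * m! * R! * 1+R * 4^k)
      ≡⟨ cong₂ (λ p q → p * q * (σk * 2^n * m! * R! * 1+R * 4^k)) (cong₂ _*_ binomial-kn ballot-cleared) poch-c ⟩
    [j-k]! * (σa * n! * 1+r) * (σk * j!) * (σk * 2^n * m! * R! * 1+R * 4^k)
      ≡⟨ msolve 11 (λ [j-k]! σa n! 1+r σk j! 2^n m! R! 1+R 4^k → ((([j-k]! ⊕m ((σa ⊕m n!) ⊕m 1+r)) ⊕m (σk ⊕m j!)) ⊕m (((((σk ⊕m 2^n) ⊕m m!) ⊕m R!) ⊕m 1+R) ⊕m 4^k)) ⊜m ((σk ⊕m σk) ⊕m (((((((((σa ⊕m 2^n) ⊕m 4^k) ⊕m j!) ⊕m 1+r) ⊕m m!) ⊕m 1+R) ⊕m R!) ⊕m n!) ⊕m [j-k]!))) refl [j-k]! σa n! 1+r σk j! 2^n m! R! 1+R 4^k ⟩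
    (σk * σk) * common
      ≡⟨ trans (cong (_* common) σk²≡1) (QP.*-identityˡ common) ⟩
    common ∎

term-i-cleared : ∀ (ιj σa σk CRr pw Pa Pb Pc hyp zᵏ T bal a! m! R! r! ιR ι2 2^r [R+k]! ιRk 1+r [1+r+k]! k! 4^k n! : ℚ) →
  CRr * r! * m! ≡ R! →
  pw * ι2 * ιR ≡ 2^r →
  Pa * a! ≡ σk * m! →
  Pb * R! * ιRk ≡ [R+k]! * ιR →
  Pc * (1+r * r!) ≡ [1+r+k]! →
  hyp * (Pc * k!) ≡ Pa * Pb →
  zᵏ ≡ σk * 4^k →
  T * ι2 * a! * n! * ιRk ≡ σa * ιj * (2^r * 4^k) * [R+k]! →
  bal * k! * [1+r+k]! ≡ σk * n! * 1+r →
  σk * σk ≡ 1ℚ →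
  r! * m! * ι2 * ιR * Pc * k! * a! * ιRk * n! * 1+r ≢ 0ℚ →
  ιj * (((σa * σk) * CRr * pw) * (hyp * zᵏ)) ≡ T * bal
term-i-cleared ιj σa σk CRr pw Pa Pb Pc hyp zᵏ T bal a! m! R! r! ιR ι2 2^r [R+k]! ιRk 1+r [1+r+k]! k! 4^k n! binomial-Rr pw-cleared poch-a poch-b poch-c hyp-cleared zᵏ≡ chebT-cleared ballot-cleared σk²≡1 D≢0 =
  *-cancelʳ D D≢0 (trans lhs*D (sym rhs*D))
  where
  open ≡-Reasoning
  D = r! * m! * ι2 * ιR * Pc * k! * a! * ιRk * n! * 1+r
  common = σa * ιj * 2^r * 4^k * m! * [R+k]! * ιR * n! * 1+r
  rest₁ = ιj * (σa * σk) * a! * ιRk * n! * 1+r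
  rest₂ = 2^r * σk * 4^k * ιj * (σa * σk) * n! * 1+r
  lhs*D : ιj * (((σa * σk) * CRr * pw) * (hyp * zᵏ)) * D ≡ σk * common
  lhs*D = begin
    ιj * (((σa * σk) * CRr * pw) * (hyp * zᵏ)) * D
      ≡⟨ msolve 17 (λ ιj σa σk CRr pw hyp zᵏ r! m! ι2 ιR Pc k! a! ιRk n! 1+r → ((ιj ⊕m ((((σa ⊕m σk) ⊕m CRr) ⊕m pw) ⊕m (hyp ⊕m zᵏ))) ⊕m (((((((((r! ⊕m m!) ⊕m ι2) ⊕m ιR) ⊕m Pc) ⊕m k!) ⊕m a!) ⊕m ιRk) ⊕m n!) ⊕m 1+r)) ⊜m ((((((CRr ⊕m r!) ⊕m m!) ⊕m ((pw ⊕m ι2) ⊕m ιR)) ⊕m (hyp ⊕m (Pc ⊕m k!))) ⊕m zᵏ) ⊕m (((((ιj ⊕m (σa ⊕m σk)) ⊕m a!) ⊕m ιRk) ⊕m n!) ⊕m 1+r))) refl ιj σa σk CRr pw hyp zᵏ r! m! ι2 ιR Pc k! a! ιRk n! 1+r ⟩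
    (CRr * r! * m!) * (pw * ι2 * ιR) * (hyp * (Pc * k!)) * zᵏ * rest₁
      ≡⟨ cong₂ (λ p q → p * q * rest₁) (cong₂ _*_ (cong₂ _*_ binomial-Rr pw-cleared) hyp-cleared) zᵏ≡ ⟩
    R! * 2^r * (Pa * Pb) * (σk * 4^k) * rest₁
      ≡⟨ msolve 12 (λ R! 2^r Pa Pb σk 4^k ιj σa a! ιRk n! 1+r → ((((R! ⊕m 2^r) ⊕m (Pa ⊕m Pb)) ⊕m (σk ⊕m 4^k)) ⊕m (((((ιj ⊕m (σa ⊕m σk)) ⊕m a!) ⊕m ιRk) ⊕m n!) ⊕m 1+r)) ⊜m (((Pa ⊕m a!) ⊕m ((Pb ⊕m R!) ⊕m ιRk)) ⊕m ((((((2^r ⊕m σk) ⊕m 4^k) ⊕m ιj) ⊕m (σa ⊕m σk)) ⊕m n!) ⊕m 1+r))) refl R! 2^r Pa Pb σk 4^k ιj σa a! ιRk n! 1+r ⟩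
    (Pa * a!) * (Pb * R! * ιRk) * rest₂
      ≡⟨ cong₂ (λ p q → p * q * rest₂) poch-a poch-b ⟩
    (σk * m!) * ([R+k]! * ιR) * rest₂
      ≡⟨ msolve 10 (λ σk m! [R+k]! ιR 2^r 4^k ιj σa n! 1+r → (((σk ⊕m m!) ⊕m ([R+k]! ⊕m ιR)) ⊕m ((((((2^r ⊕m σk) ⊕m 4^k) ⊕m ιj) ⊕m (σa ⊕m σk)) ⊕m n!) ⊕m 1+r)) ⊜m ((σk ⊕m σk) ⊕m (σk ⊕m ((((((((σa ⊕m ιj) ⊕m 2^r) ⊕m 4^k) ⊕m m!) ⊕m [R+k]!) ⊕m ιR) ⊕m n!) ⊕m 1+r)))) refl σk m! [R+k]! ιR 2^r 4^k ιj σa n! 1+r ⟩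
    (σk * σk) * (σk * common)
      ≡⟨ trans (cong (_* (σk * common)) σk²≡1) (QP.*-identityˡ (σk * common)) ⟩
    σk * common ∎
  rhs*D : T * bal * D ≡ σk * common
  rhs*D = begin
    T * bal * D
      ≡⟨ msolve 12 (λ T bal r! m! ι2 ιR Pc k! a! ιRk n! 1+r → ((T ⊕m bal) ⊕m (((((((((r! ⊕m m!) ⊕m ι2) ⊕m ιR) ⊕m Pc) ⊕m k!) ⊕m a!) ⊕m ιRk) ⊕m n!) ⊕m 1+r)) ⊜m ((((((T ⊕m ι2) ⊕m a!) ⊕m n!) ⊕m ιRk) ⊕m ((bal ⊕m k!) ⊕m (Pc ⊕m (1+r ⊕m r!)))) ⊕m (m! ⊕m ιR))) refl T bal r! m! ι2 ιR Pc k! a! ιRk n! 1+r ⟩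
    (T * ι2 * a! * n! * ιRk) * (bal * k! * (Pc * (1+r * r!))) * (m! * ιR)
      ≡⟨ cong₂ (λ p q → p * q * (m! * ιR)) chebT-cleared (cong (λ p → bal * k! * p) poch-c) ⟩
    (σa * ιj * (2^r * 4^k) * [R+k]!) * (bal * k! * [1+r+k]!) * (m! * ιR)
      ≡⟨ cong (λ p → (σa * ιj * (2^r * 4^k) * [R+k]!) * p * (m! * ιR)) ballot-cleared ⟩
    (σa * ιj * (2^r * 4^k) * [R+k]!) * (σk * n! * 1+r) * (m! * ιR)
      ≡⟨ msolve 10 (λ σa ιj 2^r 4^k [R+k]! σk n! 1+r m! ιR → (((((σa ⊕m ιj) ⊕m (2^r ⊕m 4^k)) ⊕m [R+k]!) ⊕m ((σk ⊕m n!) ⊕m 1+r)) ⊕m (m! ⊕m ιR)) ⊜m (σk ⊕m ((((((((σa ⊕m ιj) ⊕m 2^r) ⊕m 4^k) ⊕m m!) ⊕m [R+k]!) ⊕m ιR) ⊕m n!) ⊕m 1+r))) refl σa ιj 2^r 4^k [R+k]! σk n! 1+r m! ιR ⟩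
    σk * common ∎


term-ii : ∀ r a k → let j = r ℕ.+ 2 ℕ.* (a ℕ.+ k) in
  ι (2 ℕ.^ j) * (coef-ii j (a ℕ.+ k) * hypTerm-ii j (a ℕ.+ k) k) ≡ chebU j k * ballot (r ℕ.+ 2 ℕ.* a) a
term-ii r a k =
  trans (cong₂ (λ x y → x * ((y * Cjm * ratio) * (hyp * zᵏ))) 2^j≡ sgn-suc-m)
   (trans (term-ii-cleared 2^n 4^k σa σk ε Cjm ratio hyp zᵏ Pa Pb Pc Ckn bal a! [1+r+a]! [j-k]! k! R! m! j! n! 1+R 1+r binomial-jm ratio-cleared poch-a poch-b poch-c hyp-cleared zᵏ-cleared binomial-kn ballot-cleared (sgn-square k) refl denominators≢0)
     (cong (_* bal) (sym chebU-j-k)))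
  where
  m = a ℕ.+ k
  j = r ℕ.+ 2 ℕ.* m
  R = r ℕ.+ a ℕ.+ k
  j-k = R ℕ.+ a
  n = r ℕ.+ 2 ℕ.* a
  ε = - 1ℚ
  σa = sgn a
  σk = sgn k
  2^n = ι (2 ℕ.^ n)
  4^k = ι (4 ℕ.^ k)
  Cjm = ι (j C m)
  ratio = (- ι j + ι (2 ℕ.* m) - 1ℚ) ÷' (ι j - ι m + 1ℚ)
  Pa = poch (- ι m) k
  Pb = poch (- ι j + ι m - 1ℚ) k
  Pc = poch (- ι j) k
  hyp = (Pa * Pb) ÷' (Pc * ι (k !))
  zᵏ = neg-quarter ^ℚ k
  Ckn = ι ((k ℕ.+ n) C k)
  bal = ballot n a
  a! = ι (a !)
  [1+r+a]! = ι (suc (r ℕ.+ a) !)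
  [j-k]! = ι (j-k !)
  k! = ι (k !)
  R! = ι (R !)
  m! = ι (m !)
  j! = ι (j !)
  n! = ι (n !)
  1+R = ι (suc R)
  1+r = ι (suc r)
  m+R≡j′ : ∀ r a k → (a ℕ.+ k) ℕ.+ (r ℕ.+ a ℕ.+ k) ≡ r ℕ.+ 2 ℕ.* (a ℕ.+ k)
  m+R≡j′ = ℕ-Solver.solve-∀
  m+R≡j : m ℕ.+ R ≡ j
  m+R≡j = m+R≡j′ r a k
  j-k+k≡j′ : ∀ r a k → (r ℕ.+ a ℕ.+ k ℕ.+ a) ℕ.+ k ≡ r ℕ.+ 2 ℕ.* (a ℕ.+ k)
  j-k+k≡j′ = ℕ-Solver.solve-∀
  j-k+k≡j : j-k ℕ.+ k ≡ j
  j-k+k≡j = j-k+k≡j′ r a k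
  k+n≡j-k′ : ∀ r a k → k ℕ.+ (r ℕ.+ 2 ℕ.* a) ≡ r ℕ.+ a ℕ.+ k ℕ.+ a
  k+n≡j-k′ = ℕ-Solver.solve-∀
  k+n≡j-k : k ℕ.+ n ≡ j-k
  k+n≡j-k = k+n≡j-k′ r a k
  j≡n+2k′ : ∀ r a k → r ℕ.+ 2 ℕ.* (a ℕ.+ k) ≡ (r ℕ.+ 2 ℕ.* a) ℕ.+ 2 ℕ.* k
  j≡n+2k′ = ℕ-Solver.solve-∀
  j∸2k≡n : j ∸ 2 ℕ.* k ≡ n
  j∸2k≡n = trans (cong (_∸ 2 ℕ.* k) (j≡n+2k′ r a k)) (NP.m+n∸n≡m n (2 ℕ.* k))
  j≡k+n+k′ : ∀ r a k → r ℕ.+ 2 ℕ.* (a ℕ.+ k) ≡ (k ℕ.+ (r ℕ.+ 2 ℕ.* a)) ℕ.+ k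
  j≡k+n+k′ = ℕ-Solver.solve-∀
  j∸k≡k+n : j ∸ k ≡ k ℕ.+ n
  j∸k≡k+n = trans (cong (_∸ k) (j≡k+n+k′ r a k)) (NP.m+n∸n≡m (k ℕ.+ n) k)
  2^j≡ : ι (2 ℕ.^ j) ≡ 2^n * 4^k
  2^j≡ = trans (cong (λ i → ι (2 ℕ.^ i)) (j≡n+2k′ r a k)) (2^[x+2k] n k)
  sgn-suc-m : sgn (suc m) ≡ ε * (σa * σk)
  sgn-suc-m = trans (sgn-suc m) (trans (neg≡-1* (sgn m)) (cong (ε *_) (sgn-+ a k)))
    where
    neg≡-1* : ∀ x → - x ≡ (- 1ℚ) * x
    neg≡-1* = solve-∀ ℚ-ring
  chebU-j-k : chebU j k ≡ σk * 2^n * Ckn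
  chebU-j-k = cong₂ (λ x y → σk * ι (2 ℕ.^ x) * ι (y C k)) j∸2k≡n j∸k≡k+n
  ιj≡ιm+ιR : ι j ≡ ι m + ι R
  ιj≡ιm+ιR = trans (cong ι (sym m+R≡j)) (ι-+ m R)
  binomial-jm : Cjm * m! * R! ≡ j!
  binomial-jm = subst (λ z → ι (z C m) * ι (m !) * ι (R !) ≡ ι (z !)) m+R≡j (C-factorial m R)
  numerator≡ : - ι j + ι (2 ℕ.* m) - 1ℚ ≡ ε * 1+r
  numerator≡ = trans (cong (λ x → - x + ι (2 ℕ.* m) - 1ℚ) (ι-+ r (2 ℕ.* m)))
         (trans (simplify (ι r) (ι (2 ℕ.* m))) (cong (ε *_) (sym (ι-suc r))))
    where simplify : ∀ x y → - (x + y) + y - 1ℚ ≡ (- 1ℚ) * (1ℚ + x)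
          simplify = solve-∀ ℚ-ring
  denominator≡ : ι j - ι m + 1ℚ ≡ 1+R
  denominator≡ = trans (cong (λ x → x - ι m + 1ℚ) ιj≡ιm+ιR) (trans (simplify (ι m) (ι R)) (sym (ι-suc R)))
    where simplify : ∀ x y → x + y - x + 1ℚ ≡ 1ℚ + y
          simplify = solve-∀ ℚ-ring
  ratio-cleared : ratio * 1+R ≡ ε * 1+r
  ratio-cleared = trans (cong₂ (λ x y → (x ÷' y) * 1+R) numerator≡ denominator≡) (÷'-*-cancel (ε * 1+r) 1+R (ι-suc≢0 R))
  poch-a : Pa * a! ≡ σk * m!
  poch-a = poch-negate a k
  b≡ : - ι j + ι m - 1ℚ ≡ - ι (suc (r ℕ.+ a) ℕ.+ k)
  b≡ = trans (cong (λ x → - x + ι m - 1ℚ) ιj≡ιm+ιR) (trans (simplify (ι m) (ι R)) (cong -_ (sym (ι-suc R))))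
    where simplify : ∀ x y → - (x + y) + x - 1ℚ ≡ - (1ℚ + y)
          simplify = solve-∀ ℚ-ring
  poch-b : Pb * [1+r+a]! ≡ σk * (1+R * R!)
  poch-b = trans (cong (λ x → poch x k * [1+r+a]!) b≡) (trans (poch-negate (suc (r ℕ.+ a)) k) (cong (σk *_) (ι-suc-! R)))
  poch-c : Pc * [j-k]! ≡ σk * j!
  poch-c = subst (λ z → poch (- ι z) k * [j-k]! ≡ σk * ι (z !)) j-k+k≡j (poch-negate j-k k)
  Pc≢0 : Pc ≢ 0ℚ
  Pc≢0 = ≢0-if-*≡≢0 poch-c (*-≢0 (sgn≢0 k) (ι-!≢0 j))
  hyp-cleared : hyp * (Pc * k!) ≡ Pa * Pb
  hyp-cleared = ÷'-*-cancel (Pa * Pb) (Pc * k!) (*-≢0 Pc≢0 (ι-!≢0 k))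
  zᵏ-cleared : zᵏ * 4^k ≡ σk
  zᵏ-cleared = neg-quarter^k*4^k k
  binomial-kn : Ckn * k! * n! ≡ [j-k]!
  binomial-kn = subst (λ z → ι ((k ℕ.+ n) C k) * ι (k !) * ι (n !) ≡ ι (z !)) k+n≡j-k (C-factorial k n)
  ballot-cleared : bal * a! * [1+r+a]! ≡ σa * n! * 1+r
  ballot-cleared = ballot-closed r a
  denominators≢0 : m! * R! * 1+R * (Pc * k!) * 4^k * a! * [1+r+a]! * n! * [j-k]! ≢ 0ℚ
  denominators≢0 = *-≢0 (*-≢0 (*-≢0 (*-≢0 (*-≢0 (*-≢0 (*-≢0 (*-≢0 (ι-!≢0 m) (ι-!≢0 R)) (ι-suc≢0 R)) (*-≢0 Pc≢0 (ι-!≢0 k))) (ι≢0 (ℕ.≢-nonZero⁻¹ (4 ℕ.^ k) {{NP.m^n≢0 4 k}}))) (ι-!≢0 a)) (ι-!≢0 (suc (r ℕ.+ a)))) (ι-!≢0 n)) (ι-!≢0 j-k)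


term-i : ∀ r a k → let j = r ℕ.+ 2 ℕ.* (a ℕ.+ k) in 1 ≤ j →
  ι j * (coef-i j (a ℕ.+ k) * hypTerm-i j (a ℕ.+ k) k) ≡ chebT j a * ballot (r ℕ.+ 2 ℕ.* k) k
term-i r a k 1≤j =
  trans (cong₂ term-with j∸m≡R j∸2m≡r)
   (trans (cong (λ s → ιj * ((s * CRr * pw) * (hyp * zᵏ))) (sgn-+ a k))
     (term-i-cleared ιj σa σk CRr pw Pa Pb Pc hyp zᵏ T bal a! m! R! r! ιR ι2 2^r [R+k]! ιRk 1+r [1+r+k]! k! 4^k n! binomial-Rr pw-cleared poch-a poch-b poch-c hyp-cleared zᵏ≡ chebT-cleared ballot-cleared (sgn-square k) denominators≢0))
  where
  m = a ℕ.+ k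
  j = r ℕ.+ 2 ℕ.* m
  R = r ℕ.+ m
  n = r ℕ.+ 2 ℕ.* k
  term-with : ℕ → ℕ → ℚ
  term-with x y = ι j * ((sgn m * ι (x C y) * (ι (2 ℕ.^ y) ÷' ι 2 ÷' ι x)) * hypTerm m (ι x) (ι y + ι 2) (- ι 4) k)
  j≡R+m′ : ∀ r m → r ℕ.+ 2 ℕ.* m ≡ (r ℕ.+ m) ℕ.+ m
  j≡R+m′ = ℕ-Solver.solve-∀
  j∸m≡R : j ∸ m ≡ R
  j∸m≡R = trans (cong (_∸ m) (j≡R+m′ r m)) (NP.m+n∸n≡m R m)
  j∸2m≡r : j ∸ 2 ℕ.* m ≡ r
  j∸2m≡r = NP.m+n∸n≡m r (2 ℕ.* m)
  ιj = ι j
  σa = sgn a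
  σk = sgn k
  CRr = ι (R C r)
  pw = ι (2 ℕ.^ r) ÷' ι 2 ÷' ι R
  Pa = poch (- ι m) k
  Pb = poch (ι R) k
  Pc = poch (ι r + ι 2) k
  k! = ι (k !)
  hyp = (Pa * Pb) ÷' (Pc * k!)
  zᵏ = (- ι 4) ^ℚ k
  T = chebT j a
  bal = ballot n k
  a! = ι (a !)
  m! = ι (m !)
  R! = ι (R !)
  r! = ι (r !)
  ιR = ι R
  ι2 = ι 2
  2^r = ι (2 ℕ.^ r)
  [R+k]! = ι ((R ℕ.+ k) !)
  ιRk = ι (R ℕ.+ k)
  1+r = ι (suc r)
  [1+r+k]! = ι ((suc r ℕ.+ k) !)
  4^k = ι (4 ℕ.^ k)
  n! = ι (n !)
  R≢0 : R ≢ 0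
  R≢0 R≡0 with NP.m+n≡0⇒m≡0 r R≡0 | NP.m+n≡0⇒n≡0 r R≡0
  ... | r≡0 | m≡0 = NP.<⇒≢ 1≤j (sym (cong₂ (λ x y → x ℕ.+ 2 ℕ.* y) r≡0 m≡0))
  R+k≢0 : R ℕ.+ k ≢ 0
  R+k≢0 e = R≢0 (NP.m+n≡0⇒m≡0 R e)
  binomial-Rr : CRr * r! * m! ≡ R!
  binomial-Rr = C-factorial r m
  pw-cleared : pw * ι2 * ιR ≡ 2^r
  pw-cleared = trans (swap₂₃ pw ι2 ιR) (trans (cong (_* ι2) (÷'-*-cancel (2^r ÷' ι2) ιR (ι≢0 R≢0))) (÷'-*-cancel 2^r ι2 (ι-suc≢0 1)))
    where swap₂₃ : ∀ x y z → x * y * z ≡ x * z * y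
          swap₂₃ = solve-∀ ℚ-ring
  poch-a : Pa * a! ≡ σk * m!
  poch-a = poch-negate a k
  poch-b : Pb * R! * ιRk ≡ [R+k]! * ιR
  poch-b = poch-ι R k
  c≡ : ι r + ι 2 ≡ ι (suc (suc r))
  c≡ = trans (sym (ι-+ r 2)) (cong ι (NP.+-comm r 2))
  poch-c : Pc * (1+r * r!) ≡ [1+r+k]!
  poch-c = trans (cong₂ (λ x y → poch x k * y) c≡ (sym (ι-suc-! r))) (poch-ι-suc (suc r) k)
  Pc≢0 : Pc ≢ 0ℚ
  Pc≢0 = ≢0-if-*≡≢0 poch-c (ι-!≢0 (suc r ℕ.+ k))
  hyp-cleared : hyp * (Pc * k!) ≡ Pa * Pb
  hyp-cleared = ÷'-*-cancel (Pa * Pb) (Pc * k!) (*-≢0 Pc≢0 (ι-!≢0 k))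
  zᵏ≡ : zᵏ ≡ σk * 4^k
  zᵏ≡ = [-4]^k k
  chebT-cleared : T * ι2 * a! * n! * ιRk ≡ σa * ιj * (2^r * 4^k) * [R+k]!
  chebT-cleared = trans (subst₂ (λ J N → chebT J a * ι2 * a! * n! * ι N ≡ σa * ι J * ι (2 ℕ.^ n) * ι (N !)) n+2a≡j n+a≡R+k (chebT-closed n a))
                        (cong (λ x → σa * ιj * x * [R+k]!) (2^[x+2k] r k))
    where
    n+2a≡j : n ℕ.+ 2 ℕ.* a ≡ j
    n+2a≡j = n+2a≡j′ r a k
      where
      n+2a≡j′ : ∀ r a k → (r ℕ.+ 2 ℕ.* k) ℕ.+ 2 ℕ.* a ≡ r ℕ.+ 2 ℕ.* (a ℕ.+ k)
      n+2a≡j′ = ℕ-Solver.solve-∀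
    n+a≡R+k : n ℕ.+ a ≡ R ℕ.+ k
    n+a≡R+k = n+a≡R+k′ r a k
      where
      n+a≡R+k′ : ∀ r a k → (r ℕ.+ 2 ℕ.* k) ℕ.+ a ≡ (r ℕ.+ (a ℕ.+ k)) ℕ.+ k
      n+a≡R+k′ = ℕ-Solver.solve-∀
  ballot-cleared : bal * k! * [1+r+k]! ≡ σk * n! * 1+r
  ballot-cleared = ballot-closed r k
  denominators≢0 : r! * m! * ι2 * ιR * Pc * k! * a! * ιRk * n! * 1+r ≢ 0ℚ
  denominators≢0 = *-≢0 (*-≢0 (*-≢0 (*-≢0 (*-≢0 (*-≢0 (*-≢0 (*-≢0 (*-≢0 (ι-!≢0 r) (ι-!≢0 m)) (ι-suc≢0 1)) (ι≢0 R≢0)) Pc≢0) (ι-!≢0 k)) (ι-!≢0 a)) (ι≢0 R+k≢0)) (ι-!≢0 n)) (ι-suc≢0 r)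


opaque
  unfolding ι

  lhs1≡ : ∀ j → lhs1 j ≡ ι j * sumTo (j ℕ./ 2) (λ m → coef-i j m * sumTo m (hypTerm-i j m) * fibℚ (j ∸ 2 ℕ.* m ℕ.+ 1))
  lhs1≡ j = refl

  lhs2≡ : ∀ j → lhs2 j ≡ ι (2 ℕ.^ j) * sumTo (j ℕ./ 2) (λ m → coef-ii j m * sumTo m (hypTerm-ii j m) * fibℚ (j ∸ 2 ℕ.* m ℕ.+ 1))
  lhs2≡ j = refl

-- Interchanging the m- and k-sums leaves, for every k, the ballot–Fibonacci
-- sum of j - 2k, which is 1.
collapse : ∀ j X (coef : ℕ → ℚ) (H : ℕ → ℕ → ℚ) (c : ℕ → ℚ) →
  (∀ m k → 2 ℕ.* m ≤ j → k ≤ m → X * (coef m * H m k) ≡ c k * ballot (j ∸ 2 ℕ.* k) (m ∸ k)) →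
  X * sumTo (j ℕ./ 2) (λ m → coef m * sumTo m (H m) * fibℚ (j ∸ 2 ℕ.* m ℕ.+ 1)) ≡ ∑ (suc (j ℕ./ 2)) c
collapse j X coef H c term = begin
  X * sumTo h f                                          ≡⟨ cong (X *_) (sumTo≡∑ h f) ⟩
  X * ∑ (suc h) f                                        ≡⟨ ∑-*ˡ (suc h) X f ⟩
  ∑ (suc h) (λ m → X * f m)                              ≡⟨ ∑-cong (suc h) row ⟩
  ∑ (suc h) (λ m → ∑ (suc m) (λ k → G k (m ∸ k)))        ≡⟨ ∑-triangle h G ⟩
  ∑ (suc h) (λ k → ∑ (suc (h ∸ k)) (G k))                ≡⟨ ∑-cong (suc h) column ⟩
  ∑ (suc h) c                                            ∎
  where
  open ≡-Reasoning
  h = j ℕ./ 2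
  F : ℕ → ℚ
  F m = fibℚ (j ∸ 2 ℕ.* m ℕ.+ 1)
  f : ℕ → ℚ
  f m = coef m * sumTo m (H m) * F m
  G : ℕ → ℕ → ℚ
  G k l = c k * (ballot (j ∸ 2 ℕ.* k) l * fibℚ ((j ∸ 2 ℕ.* k) ∸ 2 ℕ.* l ℕ.+ 1))
  row : ∀ m → m < suc h → X * f m ≡ ∑ (suc m) (λ k → G k (m ∸ k))
  row m (s≤s m≤h) = begin
    X * (coef m * sumTo m (H m) * F m)                  ≡⟨ cong (λ s → X * (coef m * s * F m)) (sumTo≡∑ m (H m)) ⟩
    X * (coef m * ∑ (suc m) (H m) * F m)                ≡⟨ cong (λ s → X * (s * F m)) (∑-*ˡ (suc m) (coef m) (H m)) ⟩
    X * (∑ (suc m) (λ k → coef m * H m k) * F m)        ≡⟨ cong (X *_) (∑-*ʳ (suc m) (F m) (λ k → coef m * H m k)) ⟩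
    X * ∑ (suc m) (λ k → coef m * H m k * F m)          ≡⟨ ∑-*ˡ (suc m) X (λ k → coef m * H m k * F m) ⟩
    ∑ (suc m) (λ k → X * (coef m * H m k * F m))        ≡⟨ ∑-cong (suc m) (λ k k≤m → summand k (NP.≤-pred k≤m)) ⟩
    ∑ (suc m) (λ k → G k (m ∸ k))                       ∎
    where
    2m≤j : 2 ℕ.* m ≤ j
    2m≤j = NP.≤-trans (NP.*-monoʳ-≤ 2 m≤h) (2*[n/2]≤n j)
    reassociate : ∀ x p t y → x * (p * t * y) ≡ x * (p * t) * y
    reassociate = solve-∀ ℚ-ring
    summand : ∀ k → k ≤ m → X * (coef m * H m k * F m) ≡ G k (m ∸ k)
    summand k k≤m = begin
      X * (coef m * H m k * F m)                          ≡⟨ reassociate X (coef m) (H m k) (F m) ⟩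
      X * (coef m * H m k) * F m                          ≡⟨ cong₂ _*_ (term m k 2m≤j k≤m) (cong (λ i → fibℚ (i ℕ.+ 1)) (sym index)) ⟩
      c k * ballot (j ∸ 2 ℕ.* k) (m ∸ k) * fibℚ ((j ∸ 2 ℕ.* k) ∸ 2 ℕ.* (m ∸ k) ℕ.+ 1)
                                                          ≡⟨ QP.*-assoc (c k) _ _ ⟩
      G k (m ∸ k)                                         ∎
      where
      index : (j ∸ 2 ℕ.* k) ∸ 2 ℕ.* (m ∸ k) ≡ j ∸ 2 ℕ.* m
      index = trans (NP.∸-+-assoc j (2 ℕ.* k) (2 ℕ.* (m ∸ k)))
                    (cong (j ∸_) (trans (sym (NP.*-distribˡ-+ 2 k (m ∸ k))) (cong (2 ℕ.*_) (NP.m+[n∸m]≡n k≤m))))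
  column : ∀ k → k < suc h → ∑ (suc (h ∸ k)) (G k) ≡ c k
  column k _ = begin
    ∑ (suc (h ∸ k)) (G k)                               ≡⟨ ∑-*ˡ (suc (h ∸ k)) (c k) (λ l → ballot (j ∸ 2 ℕ.* k) l * fibℚ ((j ∸ 2 ℕ.* k) ∸ 2 ℕ.* l ℕ.+ 1)) ⟨
    c k * ballotFib (j ∸ 2 ℕ.* k) (h ∸ k)               ≡⟨ cong (λ i → c k * ballotFib (j ∸ 2 ℕ.* k) i) half-shift ⟨
    c k * ballotFib (j ∸ 2 ℕ.* k) ((j ∸ 2 ℕ.* k) ℕ./ 2) ≡⟨ cong (c k *_) (ballotFib-half (j ∸ 2 ℕ.* k)) ⟩
    c k * 1ℚ                                            ≡⟨ QP.*-identityʳ (c k) ⟩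
    c k                                                 ∎
    where
    half-shift : (j ∸ 2 ℕ.* k) ℕ./ 2 ≡ h ∸ k
    half-shift = trans (cong (λ i → (j ∸ i) ℕ./ 2) (NP.*-comm 2 k)) (DM.[m∸n*o]/o≡m/o∸n j k 2)

term-ii-at : ∀ j m k → 2 ℕ.* m ≤ j → k ≤ m →
  ι (2 ℕ.^ j) * (coef-ii j m * hypTerm-ii j m k) ≡ chebU j k * ballot (j ∸ 2 ℕ.* k) (m ∸ k)
term-ii-at j m k 2m≤j k≤m =
  subst₂ (λ J M → ι (2 ℕ.^ J) * (coef-ii J M * hypTerm-ii J M k) ≡ chebU J k * ballot (J ∸ 2 ℕ.* k) (M ∸ k)) j≡ m≡
    (trans (term-ii r a k) (cong₂ (λ x y → chebU (r ℕ.+ 2 ℕ.* (a ℕ.+ k)) k * ballot x y) (sym j∸2k≡) (sym (NP.m+n∸n≡m a k))))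
  where
  r = j ∸ 2 ℕ.* m
  a = m ∸ k
  m≡ : a ℕ.+ k ≡ m
  m≡ = NP.m∸n+n≡m k≤m
  j≡ : r ℕ.+ 2 ℕ.* (a ℕ.+ k) ≡ j
  j≡ = trans (cong (λ i → r ℕ.+ 2 ℕ.* i) m≡) (NP.m∸n+n≡m 2m≤j)
  j∸2k≡ : (r ℕ.+ 2 ℕ.* (a ℕ.+ k)) ∸ 2 ℕ.* k ≡ r ℕ.+ 2 ℕ.* a
  j∸2k≡ = trans (cong (_∸ 2 ℕ.* k) (j≡′ r a k)) (NP.m+n∸n≡m _ (2 ℕ.* k))
    where
    j≡′ : ∀ r a k → r ℕ.+ 2 ℕ.* (a ℕ.+ k) ≡ (r ℕ.+ 2 ℕ.* a) ℕ.+ 2 ℕ.* k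
    j≡′ = ℕ-Solver.solve-∀

term-i-at : ∀ j → 1 ≤ j → ∀ m k → 2 ℕ.* m ≤ j → k ≤ m →
  ι j * (coef-i j m * hypTerm-i j m (m ∸ k)) ≡ chebT j k * ballot (j ∸ 2 ℕ.* k) (m ∸ k)
term-i-at j 1≤j m k 2m≤j k≤m =
  subst₂ (λ J M → ι J * (coef-i J M * hypTerm-i J M (m ∸ k)) ≡ chebT J k * ballot (J ∸ 2 ℕ.* k) (m ∸ k)) j≡ m≡
    (trans (term-i r k (m ∸ k) (subst (1 ≤_) (sym j≡) 1≤j))
           (cong (λ x → chebT (r ℕ.+ 2 ℕ.* (k ℕ.+ (m ∸ k))) k * ballot x (m ∸ k)) (sym j∸2k≡)))
  where
  r = j ∸ 2 ℕ.* m
  m≡ : k ℕ.+ (m ∸ k) ≡ m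
  m≡ = NP.m+[n∸m]≡n k≤m
  j≡ : r ℕ.+ 2 ℕ.* (k ℕ.+ (m ∸ k)) ≡ j
  j≡ = trans (cong (λ i → r ℕ.+ 2 ℕ.* i) m≡) (NP.m∸n+n≡m 2m≤j)
  j∸2k≡ : (r ℕ.+ 2 ℕ.* (k ℕ.+ (m ∸ k))) ∸ 2 ℕ.* k ≡ r ℕ.+ 2 ℕ.* (m ∸ k)
  j∸2k≡ = trans (cong (_∸ 2 ℕ.* k) (j≡′ r k (m ∸ k))) (NP.m+n∸n≡m _ (2 ℕ.* k))
    where
    j≡′ : ∀ r k a → r ℕ.+ 2 ℕ.* (k ℕ.+ a) ≡ (r ℕ.+ 2 ℕ.* a) ℕ.+ 2 ℕ.* k
    j≡′ = ℕ-Solver.solve-∀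

part-ii : ∀ j → lhs2 j ≡ ⟦ suc j ⟧
part-ii j = begin
  lhs2 j                               ≡⟨ lhs2≡ j ⟩
  ι (2 ℕ.^ j) * sumTo (j ℕ./ 2) (λ m → coef-ii j m * sumTo m (hypTerm-ii j m) * fibℚ (j ∸ 2 ℕ.* m ℕ.+ 1))
                                       ≡⟨ collapse j (ι (2 ℕ.^ j)) (coef-ii j) (hypTerm-ii j) (chebU j) (term-ii-at j) ⟩
  ∑ (suc (j ℕ./ 2)) (chebU j)          ≡⟨ ∑chebU-half j ⟩
  ι (suc j)                            ≡⟨ ι≡⟦⟧ (suc j) ⟩
  ⟦ suc j ⟧                            ∎
  where open ≡-Reasoning

part-i : ∀ j → j ≥ 1 → lhs1 j ≡ ⟦ 1 ⟧
part-i j 1≤j = begin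
  lhs1 j                               ≡⟨ lhs1≡ j ⟩
  ι j * sumTo (j ℕ./ 2) (λ m → coef-i j m * sumTo m (hypTerm-i j m) * fibℚ (j ∸ 2 ℕ.* m ℕ.+ 1))
                                       ≡⟨ cong (ι j *_) (sumTo-cong (j ℕ./ 2) (λ m → cong (λ s → coef-i j m * s * fibℚ (j ∸ 2 ℕ.* m ℕ.+ 1)) (sumTo-reverse m (hypTerm-i j m)))) ⟩
  ι j * sumTo (j ℕ./ 2) (λ m → coef-i j m * sumTo m (λ k → hypTerm-i j m (m ∸ k)) * fibℚ (j ∸ 2 ℕ.* m ℕ.+ 1))
                                       ≡⟨ collapse j (ι j) (coef-i j) (λ m k → hypTerm-i j m (m ∸ k)) (chebT j) (term-i-at j 1≤j) ⟩
  ∑ (suc (j ℕ./ 2)) (chebT j)          ≡⟨ ∑chebT-half j 1≤j ⟩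
  1ℚ                                   ≡⟨ ι-1 ⟨
  ι 1                                  ≡⟨ ι≡⟦⟧ 1 ⟩
  ⟦ 1 ⟧                                ∎
  where
  open ≡-Reasoning
  sumTo-cong : ∀ n {f g} → (∀ i → f i ≡ g i) → sumTo n f ≡ sumTo n g
  sumTo-cong n {f} {g} f≡g = trans (sumTo≡∑ n f) (trans (∑-cong (suc n) (λ i _ → f≡g i)) (sym (sumTo≡∑ n g)))
  sumTo-reverse : ∀ n f → sumTo n f ≡ sumTo n (λ k → f (n ∸ k))
  sumTo-reverse n f = trans (sumTo≡∑ n f) (trans (∑-reverse (suc n) f) (sym (sumTo≡∑ n (λ k → f (n ∸ k)))))

corollary1 : ((j : ℕ) → j ≥ 1 → lhs1 j ≡ ⟦ 1 ⟧) × ((j : ℕ) → lhs2 j ≡ ⟦ suc j ⟧)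
corollary1 = part-i , part-ii
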